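{- Let $p>3$ be a prime, let $a\in\mathbb Z_p$ with $a\not\equiv 0\pmod p$. Then $$\sum_{k=0}^{p-1}\binom ak(-2)^k\equiv (-1)^{\langle a\rangle_p}-(a-\langle a\rangle_p)E_{p-2}(-a)\pmod{p^2}.$$
   Context: $\mathbb Z_p$ denotes the set of rational numbers whose denominator is not divisible by $p$. For $x,y\in\mathbb Q$, $x\equiv y\pmod{p^m}$ means $(x-y)/p^m\in\mathbb Z_p$. For $a\in\mathbb Z_p$, $\langle a\rangle_p\in\{0,1,\ldots,p-1\}$ is defined by $a\equiv\langle a\rangle_p\pmod p$. For rational $a$ and integer $k\ge0$, $\binom ak=a(a-1)\cdots(a-k+1)/k!$. The Euler numbers are defined by $E_0=1$, $E_n=-\sum_{k=1}^{[n/2]}\binom n{2k}E_{n-2k}$ for $n\ge1$, and the Euler polynomials by $E_n(x)=\frac1{2^n}\sum_{k=0}^n\binom nk(2x-1)^{n-k}E_k$. -}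

module Defs where

open import Data.Nat as ℕ using (ℕ; zero; suc; _<_; _!)
open import Data.Nat.Divisibility using (_∣_)
import Data.Nat.Properties as ℕₚ
open import Data.Nat.Combinatorics using (_C_)
open import Data.Nat.Properties using (_!≢0)
open import Data.Bool using (true; false)
open import Data.Integer as ℤ using (ℤ; +_)
open import Data.Rational as ℚ using (ℚ; ↧ₙ_; 0ℚ; 1ℚ; _+_; _*_; _-_; -_; _/_)
open import Data.Product using (Σ; _×_)
open import Relation.Nullary using (¬_)
open import Relation.Binary.PropositionalEquality using (_≡_)

-- ℤ_p : rationals whose (reduced) denominator is not divisible by p
InZp : ℕ → ℚ → Set
InZp p x = ¬ (p ∣ ↧ₙ x)

_^ℚ_ : ℚ → ℕ → ℚ
x ^ℚ zero = 1ℚ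
x ^ℚ suc n = x * (x ^ℚ n)

ℕ→ℚ : ℕ → ℚ
ℕ→ℚ n = (+ n) / 1

CongMod : ℕ → ℕ → ℚ → ℚ → Set
CongMod p m x y = Σ ℚ (λ z → InZp p z × (x - y ≡ ℕ→ℚ (p ℕ.^ m) * z))

falling : ℚ → ℕ → ℚ
falling a zero = 1ℚ
falling a (suc k) = falling a k * (a - ℕ→ℚ k)

binomℚ : ℚ → ℕ → ℚ
binomℚ a k = falling a k * ((+ 1) / (k !)) ⦃ k !≢0 ⦄

sumTo : ℕ → (ℕ → ℚ) → ℚ
sumTo zero f = 0ℚ
sumTo (suc n) f = sumTo n f + f n

Cℚ : ℕ → ℕ → ℚ
Cℚ n k = ℕ→ℚ (n C k)

-- Euler numbers: E_0 = 1, E_n = - sum_{k=1}^{[n/2]} C(n,2k) E_{n-2k}  (n ≥ 1).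
-- eulerStep n T  computes E_n from a table T valid on indices < n
eulerStep : ℕ → (ℕ → ℚ) → ℚ
eulerStep zero T = 1ℚ
eulerStep (suc n) T =
  - sumTo (ℕ._/_ (suc n) 2) (λ j → Cℚ (suc n) (2 ℕ.* suc j) * T (suc n ℕ.∸ 2 ℕ.* suc j))

-- eulerTable n i = E_i for all i ≤ n
eulerTable : ℕ → ℕ → ℚ
eulerTable zero i = eulerStep zero (λ _ → 0ℚ)
eulerTable (suc n) i with i ℕ.≤ᵇ n
... | true  = eulerTable n i
... | false = eulerStep (suc n) (eulerTable n)

euler : ℕ → ℚ
euler n = eulerTable n n

eulerPoly : ℕ → ℚ → ℚ
eulerPoly n x =
  ((+ 1) / (2 ℕ.^ n)) ⦃ ℕ.>-nonZero (ℕₚ.m^n>0 2 n) ⦄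
  * sumTo (suc n) (λ k → Cℚ n k * (((ℕ→ℚ 2 * x) - 1ℚ) ^ℚ (n ℕ.∸ k)) * euler k)

-- Put F(x) = Σ_{k<p} binom(x,k) (-2)^k and write a = pt + r. Pascal's rule gives
-- F(x + 1) = -F(x) + 2^p binom(x, p-1). Modulo p², binom(pt, k) ≡ pt (-1)^(k-1)/k for
-- 0 < k < p and binom(pt + j, p-1) ≡ pt/(j+1) for j < p-1, so with 2^p ≡ 2 one gets
-- F(pt + j) ≡ (-1)^j - pt Y_j, where Y_0 = -Σ_{0<k<p} (-1)^(k-1) (-2)^k/k and
-- Y_{j+1} = -Y_j - 2/(j+1). On the other side E_n(x) + E_n(x+1) = 2x^n, so by Fermat
-- X_j = E_{p-2}(-j) satisfies the same recurrence modulo p. Both sequences are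
-- anti-periodic: X_{p-1} ≡ E_{p-2}(1) = -X_0, and Y_{p-1} ≡ -Y_0 because (1+y)^p - y^p
-- takes the same value 2^p - 1 at y = -2 and y = 1. As p - 1 is even, X_j - Y_j alternates
-- in sign and must vanish modulo p; hence pt Y_r ≡ (a - r) E_{p-2}(-a) modulo p².

module Submission where

open import Defs
open import Data.Bool using (true; false; T)
open import Data.Integer as ℤ using (ℤ)
import Data.Integer.Properties as ℤₚ
open import Data.Integer.GCD using (gcd)
import Data.Integer.Tactic.RingSolver as ℤ-Solver
open import Data.Nat as ℕ using (ℕ; zero; suc; _<_; _≤_; _∸_; _!)
open import Data.Nat.Combinatorics using (_C_; nCk+nC[k+1]≡[n+1]C[k+1]; k>n⇒nCk≡0; nCk≡nC[n∸k])
open import Data.Nat.Divisibility using (_∣_; divides; ∣-trans; ∣1⇒≡1; ∣⇒≤)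
import Data.Nat.DivMod as ℕdm
open import Data.Nat.Primality using (Prime; euclidsLemma; ¬prime[1]; prime⇒irreducible)
import Data.Nat.Properties as ℕₚ
open import Data.Product using (_,_)
open import Data.Rational as ℚ using (ℚ; ↥_; ↧_; ↧ₙ_; 0ℚ; 1ℚ; _+_; _*_; _-_; -_; _/_; toℚᵘ)
import Data.Rational.Properties as ℚₚ
open import Algebra.Properties.Group ℚₚ.+-0-group using (⁻¹-involutive)
import Data.Rational.Unnormalised as ℚᵘ
import Data.Rational.Unnormalised.Properties as ℚᵘₚ
open import Data.Sum using (_⊎_; inj₁; inj₂)
open import Data.Unit using (tt)
open import Level using (0ℓ)
open import Relation.Binary.Bundles using (Setoid)
open import Relation.Binary.PropositionalEquality
import Relation.Binary.Reasoning.Setoid as SetoidReasoning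
open import Relation.Nullary using (¬_; yes; no; contradiction)
open import Relation.Nullary.Decidable using (dec⇒maybe)
open import Tactic.RingSolver using (solve-∀)
open import Tactic.RingSolver.Core.AlmostCommutativeRing using (AlmostCommutativeRing; fromCommutativeRing)

-- Rational numerals and reciprocals

ℚ-ring : AlmostCommutativeRing _ _
ℚ-ring = fromCommutativeRing ℚₚ.+-*-commutativeRing (λ x → dec⇒maybe (0ℚ ℚₚ.≟ x))

ℤ→ℚ : ℤ → ℚ
ℤ→ℚ i = i / 1

toℚᵘ-ℤ→ℚ : ∀ i → toℚᵘ (ℤ→ℚ i) ℚᵘ.≃ ℚᵘ.mkℚᵘ i 0
toℚᵘ-ℤ→ℚ i = ℚₚ.toℚᵘ-fromℚᵘ (ℚᵘ.mkℚᵘ i 0)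

ℤ→ℚ-+ : ∀ i j → ℤ→ℚ (i ℤ.+ j) ≡ ℤ→ℚ i + ℤ→ℚ j
ℤ→ℚ-+ i j = ℚₚ.toℚᵘ-injective (begin
  toℚᵘ (ℤ→ℚ (i ℤ.+ j))             ≈⟨ toℚᵘ-ℤ→ℚ (i ℤ.+ j) ⟩
  ℚᵘ.mkℚᵘ (i ℤ.+ j) 0               ≈⟨ ℚᵘ.*≡* (cross-multiplied i j) ⟩
  ℚᵘ.mkℚᵘ i 0 ℚᵘ.+ ℚᵘ.mkℚᵘ j 0      ≈⟨ ℚᵘₚ.+-cong (toℚᵘ-ℤ→ℚ i) (toℚᵘ-ℤ→ℚ j) ⟨
  toℚᵘ (ℤ→ℚ i) ℚᵘ.+ toℚᵘ (ℤ→ℚ j)    ≈⟨ ℚₚ.toℚᵘ-homo-+ (ℤ→ℚ i) (ℤ→ℚ j) ⟨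
  toℚᵘ (ℤ→ℚ i + ℤ→ℚ j)              ∎)
  where
  open ℚᵘₚ.≃-Reasoning
  cross-multiplied : ∀ i j → (i ℤ.+ j) ℤ.* (ℤ.+ 1 ℤ.* ℤ.+ 1) ≡ (i ℤ.* ℤ.+ 1 ℤ.+ j ℤ.* ℤ.+ 1) ℤ.* ℤ.+ 1
  cross-multiplied = ℤ-Solver.solve-∀

ℤ→ℚ-* : ∀ i j → ℤ→ℚ (i ℤ.* j) ≡ ℤ→ℚ i * ℤ→ℚ j
ℤ→ℚ-* i j = ℚₚ.toℚᵘ-injective (begin
  toℚᵘ (ℤ→ℚ (i ℤ.* j))             ≈⟨ toℚᵘ-ℤ→ℚ (i ℤ.* j) ⟩
  ℚᵘ.mkℚᵘ (i ℤ.* j) 0               ≈⟨ ℚᵘ.*≡* (cross-multiplied i j) ⟩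
  ℚᵘ.mkℚᵘ i 0 ℚᵘ.* ℚᵘ.mkℚᵘ j 0      ≈⟨ ℚᵘₚ.*-cong (toℚᵘ-ℤ→ℚ i) (toℚᵘ-ℤ→ℚ j) ⟨
  toℚᵘ (ℤ→ℚ i) ℚᵘ.* toℚᵘ (ℤ→ℚ j)    ≈⟨ ℚₚ.toℚᵘ-homo-* (ℤ→ℚ i) (ℤ→ℚ j) ⟨
  toℚᵘ (ℤ→ℚ i * ℤ→ℚ j)              ∎)
  where
  open ℚᵘₚ.≃-Reasoning
  cross-multiplied : ∀ i j → (i ℤ.* j) ℤ.* (ℤ.+ 1 ℤ.* ℤ.+ 1) ≡ (i ℤ.* j) ℤ.* ℤ.+ 1
  cross-multiplied = ℤ-Solver.solve-∀

ℕ→ℚ-+ : ∀ m n → ℕ→ℚ (m ℕ.+ n) ≡ ℕ→ℚ m + ℕ→ℚ n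
ℕ→ℚ-+ m n = ℤ→ℚ-+ (ℤ.+ m) (ℤ.+ n)

ℕ→ℚ-* : ∀ m n → ℕ→ℚ (m ℕ.* n) ≡ ℕ→ℚ m * ℕ→ℚ n
ℕ→ℚ-* m n = trans (cong ℤ→ℚ (ℤₚ.pos-* m n)) (ℤ→ℚ-* (ℤ.+ m) (ℤ.+ n))

ℕ→ℚ-suc : ∀ n → ℕ→ℚ (suc n) ≡ ℕ→ℚ n + 1ℚ
ℕ→ℚ-suc n = trans (cong ℕ→ℚ (ℕₚ.+-comm 1 n)) (ℕ→ℚ-+ n 1)

ℕ→ℚ-^ : ∀ m k → ℕ→ℚ (m ℕ.^ k) ≡ ℕ→ℚ m ^ℚ k
ℕ→ℚ-^ m zero    = refl
ℕ→ℚ-^ m (suc k) = trans (ℕ→ℚ-* m (m ℕ.^ k)) (cong (ℕ→ℚ m *_) (ℕ→ℚ-^ m k))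

ℕ→ℚ-∸ : ∀ {m n} → n ≤ m → ℕ→ℚ m - ℕ→ℚ n ≡ ℕ→ℚ (m ∸ n)
ℕ→ℚ-∸ {m} {n} n≤m = begin
  ℕ→ℚ m - ℕ→ℚ n                     ≡⟨ cong (λ k → ℕ→ℚ k - ℕ→ℚ n) (ℕₚ.m+[n∸m]≡n n≤m) ⟨
  ℕ→ℚ (n ℕ.+ (m ∸ n)) - ℕ→ℚ n       ≡⟨ cong (_- ℕ→ℚ n) (ℕ→ℚ-+ n (m ∸ n)) ⟩
  (ℕ→ℚ n + ℕ→ℚ (m ∸ n)) - ℕ→ℚ n     ≡⟨ cancel (ℕ→ℚ n) (ℕ→ℚ (m ∸ n)) ⟩
  ℕ→ℚ (m ∸ n)                       ∎
  where
  open ≡-Reasoning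
  cancel : ∀ a b → (a + b) - a ≡ b
  cancel = solve-∀ ℚ-ring

1/ℕ_ : (k : ℕ) .{{_ : ℕ.NonZero k}} → ℚ
1/ℕ k = ℤ.+ 1 / k

-- binomℚ x k unfolds to falling x k * 1/[ k !].
1/[_!] : ℕ → ℚ
1/[ k !] = (1/ℕ (k !)) {{k ℕₚ.!≢0}}

ℕ→ℚ-*-1/ℕ : ∀ k .{{_ : ℕ.NonZero k}} → ℕ→ℚ k * 1/ℕ k ≡ 1ℚ
ℕ→ℚ-*-1/ℕ (suc k) = ℚₚ.toℚᵘ-injective (begin
  toℚᵘ (ℕ→ℚ (suc k) * 1/ℕ suc k)                   ≈⟨ ℚₚ.toℚᵘ-homo-* (ℕ→ℚ (suc k)) (1/ℕ suc k) ⟩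
  toℚᵘ (ℕ→ℚ (suc k)) ℚᵘ.* toℚᵘ (1/ℕ suc k)          ≈⟨ ℚᵘₚ.*-cong (toℚᵘ-ℤ→ℚ (ℤ.+ suc k)) (ℚₚ.toℚᵘ-fromℚᵘ (ℚᵘ.mkℚᵘ (ℤ.+ 1) k)) ⟩
  ℚᵘ.mkℚᵘ (ℤ.+ suc k) 0 ℚᵘ.* ℚᵘ.mkℚᵘ (ℤ.+ 1) k      ≈⟨ ℚᵘ.*≡* (cross-multiplied (ℤ.+ suc k)) ⟩
  ℚᵘ.mkℚᵘ (ℤ.+ 1) 0                                ≈⟨ ℚₚ.toℚᵘ-fromℚᵘ (ℚᵘ.mkℚᵘ (ℤ.+ 1) 0) ⟨
  toℚᵘ 1ℚ                                          ∎)
  where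
  open ℚᵘₚ.≃-Reasoning
  cross-multiplied : ∀ x → (x ℤ.* ℤ.+ 1) ℤ.* ℤ.+ 1 ≡ ℤ.+ 1 ℤ.* (ℤ.+ 1 ℤ.* x)
  cross-multiplied = ℤ-Solver.solve-∀

!-*-1/[!] : ∀ k → ℕ→ℚ (k !) * 1/[ k !] ≡ 1ℚ
!-*-1/[!] k = ℕ→ℚ-*-1/ℕ (k !) {{k ℕₚ.!≢0}}

1/ℕ-unique : ∀ k .{{_ : ℕ.NonZero k}} {x} → x * ℕ→ℚ k ≡ 1ℚ → x ≡ 1/ℕ k
1/ℕ-unique k {x} x*k≡1 = begin
  x                         ≡⟨ ℚₚ.*-identityʳ x ⟨
  x * 1ℚ                    ≡⟨ cong (x *_) (ℕ→ℚ-*-1/ℕ k) ⟨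
  x * (ℕ→ℚ k * 1/ℕ k)       ≡⟨ ℚₚ.*-assoc x (ℕ→ℚ k) (1/ℕ k) ⟨
  x * ℕ→ℚ k * 1/ℕ k         ≡⟨ cong (_* 1/ℕ k) x*k≡1 ⟩
  1ℚ * 1/ℕ k                ≡⟨ ℚₚ.*-identityˡ (1/ℕ k) ⟩
  1/ℕ k                     ∎
  where open ≡-Reasoning

1/[suc!]-*-suc : ∀ k → 1/[ suc k !] * ℕ→ℚ (suc k) ≡ 1/[ k !]
1/[suc!]-*-suc k = 1/ℕ-unique (k !) {{k ℕₚ.!≢0}} (begin
  1/[ suc k !] * ℕ→ℚ (suc k) * ℕ→ℚ (k !)   ≡⟨ ℚₚ.*-assoc 1/[ suc k !] _ _ ⟩
  1/[ suc k !] * (ℕ→ℚ (suc k) * ℕ→ℚ (k !)) ≡⟨ cong (1/[ suc k !] *_) (ℕ→ℚ-* (suc k) (k !)) ⟨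
  1/[ suc k !] * ℕ→ℚ (suc k !)             ≡⟨ ℚₚ.*-comm 1/[ suc k !] _ ⟩
  ℕ→ℚ (suc k !) * 1/[ suc k !]             ≡⟨ !-*-1/[!] (suc k) ⟩
  1ℚ                                       ∎)
  where open ≡-Reasoning

!-*-1/[suc!] : ∀ k → ℕ→ℚ (k !) * 1/[ suc k !] ≡ 1/ℕ (suc k)
!-*-1/[suc!] k = 1/ℕ-unique (suc k) (begin
  ℕ→ℚ (k !) * 1/[ suc k !] * ℕ→ℚ (suc k)   ≡⟨ ℚₚ.*-assoc (ℕ→ℚ (k !)) _ _ ⟩
  ℕ→ℚ (k !) * (1/[ suc k !] * ℕ→ℚ (suc k)) ≡⟨ cong (ℕ→ℚ (k !) *_) (1/[suc!]-*-suc k) ⟩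
  ℕ→ℚ (k !) * 1/[ k !]                     ≡⟨ !-*-1/[!] k ⟩
  1ℚ                                       ∎)
  where open ≡-Reasoning

-- Finite sums and powers

sumTo-cong : ∀ n {f g : ℕ → ℚ} → (∀ k → k < n → f k ≡ g k) → sumTo n f ≡ sumTo n g
sumTo-cong zero    f≗g = refl
sumTo-cong (suc n) f≗g =
  cong₂ _+_ (sumTo-cong n (λ k k<n → f≗g k (ℕₚ.m<n⇒m<1+n k<n))) (f≗g n ℕₚ.≤-refl)

sumTo-zeros : ∀ n {f : ℕ → ℚ} → (∀ k → k < n → f k ≡ 0ℚ) → sumTo n f ≡ 0ℚ
sumTo-zeros n f≗0 = trans (sumTo-cong n f≗0) (all-zero n)
  where
  all-zero : ∀ n → sumTo n (λ _ → 0ℚ) ≡ 0ℚ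
  all-zero zero    = refl
  all-zero (suc n) = cong (_+ 0ℚ) (all-zero n)

sumTo-suc-head : ∀ n (f : ℕ → ℚ) → sumTo (suc n) f ≡ f 0 + sumTo n (λ k → f (suc k))
sumTo-suc-head zero    f = trans (ℚₚ.+-identityˡ (f 0)) (sym (ℚₚ.+-identityʳ (f 0)))
sumTo-suc-head (suc n) f = trans (cong (_+ f (suc n)) (sumTo-suc-head n f))
                                 (ℚₚ.+-assoc (f 0) _ (f (suc n)))

sumTo-+ : ∀ n (f g : ℕ → ℚ) → sumTo n (λ k → f k + g k) ≡ sumTo n f + sumTo n g
sumTo-+ zero    f g = refl
sumTo-+ (suc n) f g = trans (cong (_+ (f n + g n)) (sumTo-+ n f g)) (interchange (sumTo n f) (sumTo n g) (f n) (g n))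
  where
  interchange : ∀ a b c d → (a + b) + (c + d) ≡ (a + c) + (b + d)
  interchange = solve-∀ ℚ-ring

*-distribˡ-sumTo : ∀ n c (f : ℕ → ℚ) → sumTo n (λ k → c * f k) ≡ c * sumTo n f
*-distribˡ-sumTo zero    c f = sym (ℚₚ.*-zeroʳ c)
*-distribˡ-sumTo (suc n) c f = trans (cong (_+ c * f n) (*-distribˡ-sumTo n c f))
                                     (sym (ℚₚ.*-distribˡ-+ c (sumTo n f) (f n)))

sumTo-reverse : ∀ n (f : ℕ → ℚ) → sumTo (suc n) f ≡ sumTo (suc n) (λ i → f (n ∸ i))
sumTo-reverse zero    f = refl
sumTo-reverse (suc n) f = begin
  sumTo (suc (suc n)) f                                   ≡⟨ sumTo-suc-head (suc n) f ⟩
  f 0 + sumTo (suc n) (λ k → f (suc k))                   ≡⟨ cong (_+_ (f 0)) (sumTo-reverse n (λ k → f (suc k))) ⟩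
  f 0 + sumTo (suc n) (λ i → f (suc (n ∸ i)))             ≡⟨ cong (_+_ (f 0)) (sumTo-cong (suc n) suc-∸) ⟩
  f 0 + sumTo (suc n) (λ i → f (suc n ∸ i))               ≡⟨ ℚₚ.+-comm (f 0) _ ⟩
  sumTo (suc n) (λ i → f (suc n ∸ i)) + f 0               ≡⟨ cong (λ m → sumTo (suc n) (λ i → f (suc n ∸ i)) + f m) (ℕₚ.n∸n≡0 n) ⟨
  sumTo (suc n) (λ i → f (suc n ∸ i)) + f (suc n ∸ suc n) ∎
  where
  open ≡-Reasoning
  suc-∸ : ∀ i → i < suc n → f (suc (n ∸ i)) ≡ f (suc n ∸ i)
  suc-∸ i i<1+n = cong f (sym (ℕₚ.+-∸-assoc 1 (ℕₚ.≤-pred i<1+n)))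

-1^-even : ∀ q → (- 1ℚ) ^ℚ (q ℕ.+ q) ≡ 1ℚ
-1^-even zero    = refl
-1^-even (suc q) = begin
  (- 1ℚ) ^ℚ suc (q ℕ.+ suc q)           ≡⟨ cong (λ m → (- 1ℚ) ^ℚ suc m) (ℕₚ.+-suc q q) ⟩
  (- 1ℚ) * ((- 1ℚ) * (- 1ℚ) ^ℚ (q ℕ.+ q)) ≡⟨ ℚₚ.*-assoc (- 1ℚ) (- 1ℚ) ((- 1ℚ) ^ℚ (q ℕ.+ q)) ⟨
  1ℚ * (- 1ℚ) ^ℚ (q ℕ.+ q)               ≡⟨ ℚₚ.*-identityˡ _ ⟩
  (- 1ℚ) ^ℚ (q ℕ.+ q)                    ≡⟨ -1^-even q ⟩
  1ℚ                                     ∎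
  where open ≡-Reasoning

-1^-odd : ∀ q → (- 1ℚ) ^ℚ suc (q ℕ.+ q) ≡ - 1ℚ
-1^-odd q = trans (cong ((- 1ℚ) *_) (-1^-even q)) (ℚₚ.*-identityʳ (- 1ℚ))

^-neg : ∀ x k → (- x) ^ℚ k ≡ (- 1ℚ) ^ℚ k * x ^ℚ k
^-neg x zero    = refl
^-neg x (suc k) = trans (cong ((- x) *_) (^-neg x k)) (regroup x ((- 1ℚ) ^ℚ k) (x ^ℚ k))
  where
  regroup : ∀ x s X → (- x) * (s * X) ≡ ((- 1ℚ) * s) * (x * X)
  regroup = solve-∀ ℚ-ring

^-neg-odd : ∀ x q → (- x) ^ℚ suc (q ℕ.+ q) ≡ - (x ^ℚ suc (q ℕ.+ q))
^-neg-odd x q = begin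
  (- x) ^ℚ suc (q ℕ.+ q)                      ≡⟨ ^-neg x (suc (q ℕ.+ q)) ⟩
  (- 1ℚ) ^ℚ suc (q ℕ.+ q) * x ^ℚ suc (q ℕ.+ q) ≡⟨ cong (_* x ^ℚ suc (q ℕ.+ q)) (-1^-odd q) ⟩
  - 1ℚ * x ^ℚ suc (q ℕ.+ q)                   ≡⟨ ℚₚ.neg-distribˡ-* 1ℚ (x ^ℚ suc (q ℕ.+ q)) ⟨
  - (1ℚ * x ^ℚ suc (q ℕ.+ q))                 ≡⟨ cong -_ (ℚₚ.*-identityˡ (x ^ℚ suc (q ℕ.+ q))) ⟩
  - (x ^ℚ suc (q ℕ.+ q))                      ∎
  where open ≡-Reasoning

1^ : ∀ k → 1ℚ ^ℚ k ≡ 1ℚ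
1^ zero    = refl
1^ (suc k) = trans (ℚₚ.*-identityˡ (1ℚ ^ℚ k)) (1^ k)

0^-suc : ∀ k → 0ℚ ^ℚ suc k ≡ 0ℚ
0^-suc k = ℚₚ.*-zeroˡ (0ℚ ^ℚ k)

*-^ : ∀ x y k → (x * y) ^ℚ k ≡ x ^ℚ k * y ^ℚ k
*-^ x y zero    = refl
*-^ x y (suc k) = trans (cong ((x * y) *_) (*-^ x y k)) (interchange x y (x ^ℚ k) (y ^ℚ k))
  where
  interchange : ∀ x y a b → (x * y) * (a * b) ≡ (x * a) * (y * b)
  interchange = solve-∀ ℚ-ring

-- Falling factorials and binomial coefficients

falling-pascal : ∀ x k → falling (x + 1ℚ) (suc k) ≡ falling x (suc k) + ℕ→ℚ (suc k) * falling x k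
falling-pascal x zero    = expand x
  where
  expand : ∀ x → 1ℚ * ((x + 1ℚ) - 0ℚ) ≡ 1ℚ * (x - 0ℚ) + 1ℚ * 1ℚ
  expand = solve-∀ ℚ-ring
falling-pascal x (suc k) = begin
  falling (x + 1ℚ) (suc k) * ((x + 1ℚ) - ℕ→ℚ (suc k))
    ≡⟨ cong₂ (λ a b → a * ((x + 1ℚ) - b)) (falling-pascal x k) (ℕ→ℚ-suc k) ⟩
  (falling x k * (x - n) + ℕ→ℚ (suc k) * falling x k) * ((x + 1ℚ) - (n + 1ℚ))
    ≡⟨ cong (λ b → (falling x k * (x - n) + b * falling x k) * ((x + 1ℚ) - (n + 1ℚ))) (ℕ→ℚ-suc k) ⟩
  (falling x k * (x - n) + (n + 1ℚ) * falling x k) * ((x + 1ℚ) - (n + 1ℚ))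
    ≡⟨ expand (falling x k) x n ⟩
  falling x k * (x - n) * (x - (n + 1ℚ)) + ((n + 1ℚ) + 1ℚ) * (falling x k * (x - n))
    ≡⟨ cong₂ (λ a b → falling x k * (x - n) * (x - a) + b * (falling x k * (x - n)))
             (sym (ℕ→ℚ-suc k)) (sym (trans (ℕ→ℚ-suc (suc k)) (cong (_+ 1ℚ) (ℕ→ℚ-suc k)))) ⟩
  falling x k * (x - n) * (x - ℕ→ℚ (suc k)) + ℕ→ℚ (suc (suc k)) * (falling x k * (x - n)) ∎
  where
  open ≡-Reasoning
  n = ℕ→ℚ k
  expand : ∀ F x n → (F * (x - n) + (n + 1ℚ) * F) * ((x + 1ℚ) - (n + 1ℚ))
                   ≡ F * (x - n) * (x - (n + 1ℚ)) + ((n + 1ℚ) + 1ℚ) * (F * (x - n))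
  expand = solve-∀ ℚ-ring

binomℚ-pascal : ∀ x k → binomℚ (x + 1ℚ) (suc k) ≡ binomℚ x (suc k) + binomℚ x k
binomℚ-pascal x k = begin
  falling (x + 1ℚ) (suc k) * 1/[ suc k !]
    ≡⟨ cong (_* 1/[ suc k !]) (falling-pascal x k) ⟩
  (falling x (suc k) + ℕ→ℚ (suc k) * falling x k) * 1/[ suc k !]
    ≡⟨ distribute (falling x (suc k)) (ℕ→ℚ (suc k)) (falling x k) 1/[ suc k !] ⟩
  falling x (suc k) * 1/[ suc k !] + falling x k * (1/[ suc k !] * ℕ→ℚ (suc k))
    ≡⟨ cong (λ w → falling x (suc k) * 1/[ suc k !] + falling x k * w) (1/[suc!]-*-suc k) ⟩
  falling x (suc k) * 1/[ suc k !] + falling x k * 1/[ k !] ∎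
  where
  open ≡-Reasoning
  distribute : ∀ a b c i → (a + b * c) * i ≡ a * i + c * (i * b)
  distribute = solve-∀ ℚ-ring

falling-suc-head : ∀ x k → falling x (suc k) ≡ x * falling (x - 1ℚ) k
falling-suc-head x zero    = trans (ℚₚ.*-identityˡ (x - 0ℚ)) (trans (ℚₚ.+-identityʳ x) (sym (ℚₚ.*-identityʳ x)))
falling-suc-head x (suc k) = begin
  falling x (suc k) * (x - ℕ→ℚ (suc k))           ≡⟨ cong₂ (λ a b → a * (x - b)) (falling-suc-head x k) (ℕ→ℚ-suc k) ⟩
  x * falling (x - 1ℚ) k * (x - (ℕ→ℚ k + 1ℚ))     ≡⟨ regroup x (falling (x - 1ℚ) k) (ℕ→ℚ k) ⟩
  x * (falling (x - 1ℚ) k * ((x - 1ℚ) - ℕ→ℚ k))   ∎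
  where
  open ≡-Reasoning
  regroup : ∀ x F n → x * F * (x - (n + 1ℚ)) ≡ x * (F * ((x - 1ℚ) - n))
  regroup = solve-∀ ℚ-ring

falling-+ : ∀ x k l → falling x (k ℕ.+ l) ≡ falling x k * falling (x - ℕ→ℚ k) l
falling-+ x k zero    = trans (cong (falling x) (ℕₚ.+-identityʳ k)) (sym (ℚₚ.*-identityʳ (falling x k)))
falling-+ x k (suc l) = begin
  falling x (k ℕ.+ suc l)                                       ≡⟨ cong (falling x) (ℕₚ.+-suc k l) ⟩
  falling x (k ℕ.+ l) * (x - ℕ→ℚ (k ℕ.+ l))                     ≡⟨ cong₂ (λ a b → a * (x - b)) (falling-+ x k l) (ℕ→ℚ-+ k l) ⟩
  falling x k * falling (x - ℕ→ℚ k) l * (x - (ℕ→ℚ k + ℕ→ℚ l))   ≡⟨ regroup (falling x k) (falling (x - ℕ→ℚ k) l) x (ℕ→ℚ k) (ℕ→ℚ l) ⟩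
  falling x k * (falling (x - ℕ→ℚ k) l * ((x - ℕ→ℚ k) - ℕ→ℚ l)) ∎
  where
  open ≡-Reasoning
  regroup : ∀ a b x k l → a * b * (x - (k + l)) ≡ a * (b * ((x - k) - l))
  regroup = solve-∀ ℚ-ring

falling-−1 : ∀ k → falling (- 1ℚ) k ≡ (- 1ℚ) ^ℚ k * ℕ→ℚ (k !)
falling-−1 zero    = refl
falling-−1 (suc k) = begin
  falling (- 1ℚ) k * ((- 1ℚ) - ℕ→ℚ k)                        ≡⟨ cong (_* ((- 1ℚ) - ℕ→ℚ k)) (falling-−1 k) ⟩
  (- 1ℚ) ^ℚ k * ℕ→ℚ (k !) * ((- 1ℚ) - ℕ→ℚ k)                 ≡⟨ regroup ((- 1ℚ) ^ℚ k) (ℕ→ℚ (k !)) (ℕ→ℚ k) ⟩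
  (- 1ℚ) * (- 1ℚ) ^ℚ k * ((ℕ→ℚ k + 1ℚ) * ℕ→ℚ (k !))          ≡⟨ cong (λ w → (- 1ℚ) * (- 1ℚ) ^ℚ k * (w * ℕ→ℚ (k !))) (ℕ→ℚ-suc k) ⟨
  (- 1ℚ) * (- 1ℚ) ^ℚ k * (ℕ→ℚ (suc k) * ℕ→ℚ (k !))           ≡⟨ cong ((- 1ℚ) * (- 1ℚ) ^ℚ k *_) (ℕ→ℚ-* (suc k) (k !)) ⟨
  (- 1ℚ) * (- 1ℚ) ^ℚ k * ℕ→ℚ (suc k !)                       ∎
  where
  open ≡-Reasoning
  regroup : ∀ s f n → s * f * ((- 1ℚ) - n) ≡ (- 1ℚ) * s * ((n + 1ℚ) * f)
  regroup = solve-∀ ℚ-ring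

falling-self : ∀ n → falling (ℕ→ℚ n) n ≡ ℕ→ℚ (n !)
falling-self zero    = refl
falling-self (suc n) = begin
  falling (ℕ→ℚ (suc n)) (suc n)               ≡⟨ falling-suc-head (ℕ→ℚ (suc n)) n ⟩
  ℕ→ℚ (suc n) * falling (ℕ→ℚ (suc n) - 1ℚ) n  ≡⟨ cong (λ w → ℕ→ℚ (suc n) * falling w n) [n+1]-1≡n ⟩
  ℕ→ℚ (suc n) * falling (ℕ→ℚ n) n             ≡⟨ cong (ℕ→ℚ (suc n) *_) (falling-self n) ⟩
  ℕ→ℚ (suc n) * ℕ→ℚ (n !)                     ≡⟨ ℕ→ℚ-* (suc n) (n !) ⟨
  ℕ→ℚ (suc n !)                               ∎
  where
  open ≡-Reasoning
  [n+1]-1≡n : ℕ→ℚ (suc n) - 1ℚ ≡ ℕ→ℚ n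
  [n+1]-1≡n = trans (cong (_- 1ℚ) (ℕ→ℚ-suc n)) (cancel (ℕ→ℚ n))
    where
    cancel : ∀ x → (x + 1ℚ) - 1ℚ ≡ x
    cancel = solve-∀ ℚ-ring

n<k⇒falling[n,k]≡0 : ∀ {n k} → n < k → falling (ℕ→ℚ n) k ≡ 0ℚ
n<k⇒falling[n,k]≡0 {n} {suc k} n<1+k with n ℕ.≟ k
... | yes refl = trans (cong (falling (ℕ→ℚ n) n *_) (ℚₚ.+-inverseʳ (ℕ→ℚ n))) (ℚₚ.*-zeroʳ (falling (ℕ→ℚ n) n))
... | no n≢k   = trans (cong (_* (ℕ→ℚ n - ℕ→ℚ k)) (n<k⇒falling[n,k]≡0 (ℕₚ.≤∧≢⇒< (ℕₚ.≤-pred n<1+k) n≢k)))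
                       (ℚₚ.*-zeroˡ (ℕ→ℚ n - ℕ→ℚ k))

binomℚ[n,n]≡1 : ∀ n → binomℚ (ℕ→ℚ n) n ≡ 1ℚ
binomℚ[n,n]≡1 n = trans (cong (_* 1/[ n !]) (falling-self n)) (!-*-1/[!] n)

n<k⇒binomℚ[n,k]≡0 : ∀ {n k} → n < k → binomℚ (ℕ→ℚ n) k ≡ 0ℚ
n<k⇒binomℚ[n,k]≡0 {k = k} n<k = trans (cong (_* 1/[ k !]) (n<k⇒falling[n,k]≡0 n<k)) (ℚₚ.*-zeroˡ 1/[ k !])

binomialSum : ℕ → ℚ → ℚ → ℚ
binomialSum M x y = sumTo (suc M) (λ k → binomℚ x k * y ^ℚ k)

binomialSum-suc : ∀ M x y →
  binomialSum M (x + 1ℚ) y ≡ (1ℚ + y) * binomialSum M x y - y ^ℚ suc M * binomℚ x M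
binomialSum-suc zero    x y = expand y
  where
  expand : ∀ y → 0ℚ + (1ℚ * 1ℚ) * 1ℚ ≡ (1ℚ + y) * (0ℚ + (1ℚ * 1ℚ) * 1ℚ) - (y * 1ℚ) * (1ℚ * 1ℚ)
  expand = solve-∀ ℚ-ring
binomialSum-suc (suc M) x y = begin
  binomialSum M (x + 1ℚ) y + binomℚ (x + 1ℚ) (suc M) * Y
    ≡⟨ cong₂ (λ a b → a + b * Y) (binomialSum-suc M x y) (binomℚ-pascal x M) ⟩
  ((1ℚ + y) * binomialSum M x y - Y * binomℚ x M) + (binomℚ x (suc M) + binomℚ x M) * Y
    ≡⟨ regroup (binomialSum M x y) (binomℚ x M) (binomℚ x (suc M)) Y y ⟩
  (1ℚ + y) * (binomialSum M x y + binomℚ x (suc M) * Y) - (y * Y) * binomℚ x (suc M) ∎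
  where
  open ≡-Reasoning
  Y = y ^ℚ suc M
  regroup : ∀ g b₀ b₁ Y y → ((1ℚ + y) * g - Y * b₀) + (b₁ + b₀) * Y
                         ≡ (1ℚ + y) * (g + b₁ * Y) - (y * Y) * b₁
  regroup = solve-∀ ℚ-ring

binomialSum-ℕ : ∀ M {n} y → n ≤ M → binomialSum M (ℕ→ℚ n) y ≡ (1ℚ + y) ^ℚ n
binomialSum-ℕ M {zero} y _ = begin
  binomialSum M 0ℚ y                                        ≡⟨ sumTo-suc-head M _ ⟩
  1ℚ + sumTo M (λ k → binomℚ 0ℚ (suc k) * y ^ℚ suc k)      ≡⟨ cong (_+_ 1ℚ) (sumTo-zeros M higher-terms-vanish) ⟩
  1ℚ + 0ℚ                                                   ≡⟨⟩
  1ℚ                                                        ∎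
  where
  open ≡-Reasoning
  higher-terms-vanish : ∀ k → k < M → binomℚ 0ℚ (suc k) * y ^ℚ suc k ≡ 0ℚ
  higher-terms-vanish k _ = trans (cong (_* y ^ℚ suc k) (n<k⇒binomℚ[n,k]≡0 {k = suc k} (ℕ.s≤s ℕ.z≤n)))
                                  (ℚₚ.*-zeroˡ (y ^ℚ suc k))
binomialSum-ℕ M {suc n} y 1+n≤M = begin
  binomialSum M (ℕ→ℚ (suc n)) y
    ≡⟨ cong (λ w → binomialSum M w y) (ℕ→ℚ-suc n) ⟩
  binomialSum M (ℕ→ℚ n + 1ℚ) y
    ≡⟨ binomialSum-suc M (ℕ→ℚ n) y ⟩
  (1ℚ + y) * binomialSum M (ℕ→ℚ n) y - y ^ℚ suc M * binomℚ (ℕ→ℚ n) M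
    ≡⟨ cong₂ (λ a b → (1ℚ + y) * a - y ^ℚ suc M * b)
             (binomialSum-ℕ M y (ℕₚ.<⇒≤ 1+n≤M)) (n<k⇒binomℚ[n,k]≡0 1+n≤M) ⟩
  (1ℚ + y) * (1ℚ + y) ^ℚ n - y ^ℚ suc M * 0ℚ
    ≡⟨ drop-zero ((1ℚ + y) ^ℚ suc n) (y ^ℚ suc M) ⟩
  (1ℚ + y) ^ℚ suc n ∎
  where
  open ≡-Reasoning
  drop-zero : ∀ a c → a - c * 0ℚ ≡ a
  drop-zero = solve-∀ ℚ-ring

binomialSum-suc-top : ∀ M y → binomialSum M (ℕ→ℚ (suc M)) y ≡ (1ℚ + y) ^ℚ suc M - y ^ℚ suc M
binomialSum-suc-top M y = begin
  binomialSum M (ℕ→ℚ (suc M)) y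
    ≡⟨ cong (λ w → binomialSum M w y) (ℕ→ℚ-suc M) ⟩
  binomialSum M (ℕ→ℚ M + 1ℚ) y
    ≡⟨ binomialSum-suc M (ℕ→ℚ M) y ⟩
  (1ℚ + y) * binomialSum M (ℕ→ℚ M) y - y ^ℚ suc M * binomℚ (ℕ→ℚ M) M
    ≡⟨ cong₂ (λ a b → (1ℚ + y) * a - y ^ℚ suc M * b) (binomialSum-ℕ M y ℕₚ.≤-refl) (binomℚ[n,n]≡1 M) ⟩
  (1ℚ + y) ^ℚ suc M - y ^ℚ suc M * 1ℚ
    ≡⟨ cong (λ w → (1ℚ + y) ^ℚ suc M - w) (ℚₚ.*-identityʳ (y ^ℚ suc M)) ⟩
  (1ℚ + y) ^ℚ suc M - y ^ℚ suc M ∎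
  where open ≡-Reasoning

-- Appell sums and Euler polynomials

-- eulerPoly n x unfolds to 1/2^ n * appell n euler (2x - 1).
appell : ℕ → (ℕ → ℚ) → ℚ → ℚ
appell n a z = sumTo (suc n) (λ k → Cℚ n k * z ^ℚ (n ∸ k) * a k)

appell-cong : ∀ n {a b : ℕ → ℚ} z → (∀ k → k ≤ n → a k ≡ b k) → appell n a z ≡ appell n b z
appell-cong n z a≗b = sumTo-cong (suc n) (λ k k≤n → cong (Cℚ n k * z ^ℚ (n ∸ k) *_) (a≗b k (ℕₚ.≤-pred k≤n)))

appell-linear : ∀ n c (a b : ℕ → ℚ) z → appell n (λ k → c * a k + b k) z ≡ c * appell n a z + appell n b z
appell-linear n c a b z = begin
  appell n (λ k → c * a k + b k) z
    ≡⟨ sumTo-cong (suc n) (λ k _ → distribute (Cℚ n k * z ^ℚ (n ∸ k)) c (a k) (b k)) ⟩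
  sumTo (suc n) (λ k → c * (Cℚ n k * z ^ℚ (n ∸ k) * a k) + Cℚ n k * z ^ℚ (n ∸ k) * b k)
    ≡⟨ sumTo-+ (suc n) _ _ ⟩
  sumTo (suc n) (λ k → c * (Cℚ n k * z ^ℚ (n ∸ k) * a k)) + appell n b z
    ≡⟨ cong (_+ appell n b z) (*-distribˡ-sumTo (suc n) c _) ⟩
  c * appell n a z + appell n b z ∎
  where
  open ≡-Reasoning
  distribute : ∀ w c a b → w * (c * a + b) ≡ c * (w * a) + w * b
  distribute = solve-∀ ℚ-ring

appell-suc : ∀ n (a : ℕ → ℚ) z → appell (suc n) a z ≡ z * appell n a z + appell n (λ k → a (suc k)) z
appell-suc n a z = begin
  appell (suc n) a z
    ≡⟨ sumTo-suc-head (suc n) _ ⟩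
  Cℚ (suc n) 0 * z ^ℚ suc n * a 0 + sumTo (suc n) (λ k → Cℚ (suc n) (suc k) * z ^ℚ (n ∸ k) * a (suc k))
    ≡⟨ cong (Cℚ (suc n) 0 * z ^ℚ suc n * a 0 +_) (trans (sumTo-cong (suc n) (λ k _ → pascal k)) (sumTo-+ (suc n) _ _)) ⟩
  Cℚ (suc n) 0 * z ^ℚ suc n * a 0 + (appell n (λ k → a (suc k)) z + sumTo (suc n) (λ k → Cℚ n (suc k) * z ^ℚ (n ∸ k) * a (suc k)))
    ≡⟨ cong (λ w → Cℚ (suc n) 0 * z ^ℚ suc n * a 0 + (appell n (λ k → a (suc k)) z + w)) factor-z ⟩
  Cℚ (suc n) 0 * z ^ℚ suc n * a 0 + (appell n (λ k → a (suc k)) z + z * tail)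
    ≡⟨ regroup (z ^ℚ n) z (a 0) (appell n (λ k → a (suc k)) z) tail ⟩
  z * (Cℚ n 0 * z ^ℚ n * a 0 + tail) + appell n (λ k → a (suc k)) z
    ≡⟨ cong (λ w → z * w + appell n (λ k → a (suc k)) z) (sumTo-suc-head n _) ⟨
  z * appell n a z + appell n (λ k → a (suc k)) z ∎
  where
  open ≡-Reasoning
  tail = sumTo n (λ k → Cℚ n (suc k) * z ^ℚ (n ∸ suc k) * a (suc k))
  term : ℕ → ℕ → ℚ
  term c k = ℕ→ℚ c * z ^ℚ (n ∸ k) * a (suc k)
  pascal : ∀ k → term (suc n C suc k) k ≡ term (n C k) k + term (n C suc k) k
  pascal k = begin
    term (suc n C suc k) k                                     ≡⟨ cong (λ c → term c k) (nCk+nC[k+1]≡[n+1]C[k+1] n k) ⟨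
    term (n C k ℕ.+ n C suc k) k                               ≡⟨ cong (λ c → c * z ^ℚ (n ∸ k) * a (suc k)) (ℕ→ℚ-+ (n C k) (n C suc k)) ⟩
    (Cℚ n k + Cℚ n (suc k)) * z ^ℚ (n ∸ k) * a (suc k)         ≡⟨ distribute (Cℚ n k) (Cℚ n (suc k)) (z ^ℚ (n ∸ k)) (a (suc k)) ⟩
    term (n C k) k + term (n C suc k) k                        ∎
    where
    distribute : ∀ a b c d → (a + b) * c * d ≡ a * c * d + b * c * d
    distribute = solve-∀ ℚ-ring
  factor-z : sumTo (suc n) (λ k → term (n C suc k) k) ≡ z * tail
  factor-z = begin
    sumTo n (λ k → term (n C suc k) k) + term (n C suc n) n
      ≡⟨ cong₂ _+_ (sumTo-cong n (λ k k<n → pull-z k (ℕₚ.+-∸-assoc 1 k<n)))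
                   (cong (λ c → term c n) (k>n⇒nCk≡0 (ℕₚ.n<1+n n))) ⟩
    sumTo n (λ k → z * (Cℚ n (suc k) * z ^ℚ (n ∸ suc k) * a (suc k))) + 0ℚ * z ^ℚ (n ∸ n) * a (suc n)
      ≡⟨ cong (sumTo n (λ k → z * (Cℚ n (suc k) * z ^ℚ (n ∸ suc k) * a (suc k))) +_)
              (trans (cong (_* a (suc n)) (ℚₚ.*-zeroˡ (z ^ℚ (n ∸ n)))) (ℚₚ.*-zeroˡ (a (suc n)))) ⟩
    sumTo n (λ k → z * (Cℚ n (suc k) * z ^ℚ (n ∸ suc k) * a (suc k))) + 0ℚ
      ≡⟨ trans (ℚₚ.+-identityʳ _) (*-distribˡ-sumTo n z _) ⟩
    z * tail ∎
    where
    pull-z : ∀ k → n ∸ k ≡ suc (n ∸ suc k) → term (n C suc k) k ≡ z * (Cℚ n (suc k) * z ^ℚ (n ∸ suc k) * a (suc k))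
    pull-z k eq = trans (cong (λ m → Cℚ n (suc k) * z ^ℚ m * a (suc k)) eq)
                        (regroup′ (Cℚ n (suc k)) z (z ^ℚ (n ∸ suc k)) (a (suc k)))
      where
      regroup′ : ∀ c z Z a → c * (z * Z) * a ≡ z * (c * Z * a)
      regroup′ = solve-∀ ℚ-ring
  regroup : ∀ Zⁿ z a₀ B T → (1ℚ * (z * Zⁿ) * a₀) + (B + z * T) ≡ z * (1ℚ * Zⁿ * a₀ + T) + B
  regroup = solve-∀ ℚ-ring

appell-shift : ∀ n (a : ℕ → ℚ) z c → appell n a (z + c) ≡ appell n (λ j → appell j a c) z
appell-shift zero    a z c = constant (a 0)
  where
  constant : ∀ a → 0ℚ + 1ℚ * 1ℚ * a ≡ 0ℚ + 1ℚ * 1ℚ * (0ℚ + 1ℚ * 1ℚ * a)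
  constant = solve-∀ ℚ-ring
appell-shift (suc n) a z c = begin
  appell (suc n) a (z + c)                                ≡⟨ appell-suc n a (z + c) ⟩
  (z + c) * appell n a (z + c) + appell n a′ (z + c)      ≡⟨ cong₂ (λ u v → (z + c) * u + v) (appell-shift n a z c) (appell-shift n a′ z c) ⟩
  (z + c) * appell n A z + appell n A′ z                  ≡⟨ regroup z c (appell n A z) (appell n A′ z) ⟩
  z * appell n A z + (c * appell n A z + appell n A′ z)   ≡⟨ cong (z * appell n A z +_) (appell-linear n c A A′ z) ⟨
  z * appell n A z + appell n (λ j → c * A j + A′ j) z    ≡⟨ cong (z * appell n A z +_) (appell-cong n z (λ j _ → sym (appell-suc j a c))) ⟩
  z * appell n A z + appell n (λ j → A (suc j)) z         ≡⟨ appell-suc n A z ⟨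
  appell (suc n) A z                                      ∎
  where
  open ≡-Reasoning
  a′ = λ k → a (suc k)
  A  = λ j → appell j a c
  A′ = λ j → appell j a′ c
  regroup : ∀ z c A B → (z + c) * A + B ≡ z * A + (c * A + B)
  regroup = solve-∀ ℚ-ring

eulerTable-stable : ∀ n {i} → i ≤ n → eulerTable (suc n) i ≡ eulerTable n i
eulerTable-stable n {i} i≤n with i ℕ.≤ᵇ n | ℕₚ.≤⇒≤ᵇ i≤n
... | true  | _ = refl

eulerTable-≤ : ∀ n {i} → i ≤ n → eulerTable n i ≡ euler i
eulerTable-≤ zero    ℕ.z≤n = refl
eulerTable-≤ (suc n) {i} i≤1+n with i ℕ.≟ suc n
... | yes refl = refl
... | no i≢1+n = trans (eulerTable-stable n i≤n) (eulerTable-≤ n i≤n)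
  where i≤n = ℕₚ.≤-pred (ℕₚ.≤∧≢⇒< i≤1+n i≢1+n)

euler-suc : ∀ k → euler (suc k) ≡ - sumTo (suc k ℕ./ 2) (λ j → Cℚ (suc k) (2 ℕ.* suc j) * euler (suc k ∸ 2 ℕ.* suc j))
euler-suc k = trans top-entry (cong -_ (sumTo-cong (suc k ℕ./ 2) (λ j _ → cong (Cℚ (suc k) (2 ℕ.* suc j) *_)
                                       (eulerTable-≤ k (ℕₚ.m∸n≤m k (j ℕ.+ suc (j ℕ.+ 0)))))))
  where
  top-entry : eulerTable (suc k) (suc k) ≡ eulerStep (suc k) (eulerTable k)
  top-entry with suc k ℕ.≤ᵇ k in eq
  ... | true  = contradiction (ℕₚ.≤ᵇ⇒≤ (suc k) k (subst T (sym eq) tt)) (ℕₚ.<-irrefl refl)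
  ... | false = refl

half-suc-suc : ∀ m → suc (suc m) ℕ./ 2 ≡ suc (m ℕ./ 2)
half-suc-suc m = ℕdm.m/n≡1+[m∸n]/n {suc (suc m)} {2} (ℕ.s≤s (ℕ.s≤s ℕ.z≤n))

even⊎odd : ∀ m → m ≡ m ℕ./ 2 ℕ.+ m ℕ./ 2 ⊎ m ≡ suc (m ℕ./ 2 ℕ.+ m ℕ./ 2)
even⊎odd zero          = inj₁ refl
even⊎odd (suc zero)    = inj₂ refl
even⊎odd (suc (suc m)) rewrite half-suc-suc m with even⊎odd m
... | inj₁ m≡h+h   = inj₁ (cong suc (trans (cong suc m≡h+h) (sym (ℕₚ.+-suc _ _))))
... | inj₂ m≡1+h+h = inj₂ (cong suc (trans (cong suc m≡1+h+h) (cong suc (sym (ℕₚ.+-suc _ _)))))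

twiceIfEven : ℕ → ℚ
twiceIfEven i = (- 1ℚ) ^ℚ i + 1ℚ

twiceIfEven-even : ∀ q → twiceIfEven (q ℕ.+ q) ≡ ℕ→ℚ 2
twiceIfEven-even q = cong (_+ 1ℚ) (-1^-even q)

*-twiceIfEven-odd : ∀ x q → x * twiceIfEven (suc (q ℕ.+ q)) ≡ 0ℚ
*-twiceIfEven-odd x q = trans (cong (λ w → x * (w + 1ℚ)) (-1^-odd q)) (ℚₚ.*-zeroʳ x)

sumTo-twiceIfEven-even : ∀ q (g : ℕ → ℚ) →
  sumTo (suc (q ℕ.+ q)) (λ i → g i * twiceIfEven i) ≡ ℕ→ℚ 2 * sumTo (suc q) (λ l → g (l ℕ.+ l))
sumTo-twiceIfEven-even zero    g = trans (ℚₚ.+-identityˡ _) (trans (cong (g 0 *_) (twiceIfEven-even 0))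
                                         (trans (ℚₚ.*-comm (g 0) _) (cong (ℕ→ℚ 2 *_) (sym (ℚₚ.+-identityˡ (g 0))))))
sumTo-twiceIfEven-even (suc q) g = begin
  sumTo (suc (suc q ℕ.+ suc q)) f
    ≡⟨ cong (λ m → sumTo (suc (suc m)) f) (ℕₚ.+-suc q q) ⟩
  sumTo (suc (q ℕ.+ q)) f + f (suc (q ℕ.+ q)) + f (suc (suc (q ℕ.+ q)))
    ≡⟨ cong₂ (λ a b → a + b + f (suc (suc (q ℕ.+ q)))) (sumTo-twiceIfEven-even q g) (*-twiceIfEven-odd (g (suc (q ℕ.+ q))) q) ⟩
  ℕ→ℚ 2 * S + 0ℚ + f (suc (suc (q ℕ.+ q)))
    ≡⟨ cong (λ w → ℕ→ℚ 2 * S + 0ℚ + w) even-term ⟩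
  ℕ→ℚ 2 * S + 0ℚ + g (suc q ℕ.+ suc q) * ℕ→ℚ 2
    ≡⟨ regroup (ℕ→ℚ 2) S (g (suc q ℕ.+ suc q)) ⟩
  ℕ→ℚ 2 * (S + g (suc q ℕ.+ suc q)) ∎
  where
  open ≡-Reasoning
  f = λ i → g i * twiceIfEven i
  S = sumTo (suc q) (λ l → g (l ℕ.+ l))
  even-term : f (suc (suc (q ℕ.+ q))) ≡ g (suc q ℕ.+ suc q) * ℕ→ℚ 2
  even-term = trans (cong f (cong suc (sym (ℕₚ.+-suc q q))))
                    (cong (g (suc q ℕ.+ suc q) *_) (twiceIfEven-even (suc q)))
  regroup : ∀ t S a → t * S + 0ℚ + a * t ≡ t * (S + a)
  regroup = solve-∀ ℚ-ring

sumTo-twiceIfEven : ∀ j (g : ℕ → ℚ) →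
  sumTo (suc j) (λ i → g i * twiceIfEven i) ≡ ℕ→ℚ 2 * sumTo (suc (j ℕ./ 2)) (λ l → g (l ℕ.+ l))
sumTo-twiceIfEven j g with even⊎odd j
... | inj₁ j≡h+h = trans (cong (λ m → sumTo (suc m) (λ i → g i * twiceIfEven i)) j≡h+h)
                         (sumTo-twiceIfEven-even (j ℕ./ 2) g)
... | inj₂ j≡1+h+h = begin
  sumTo (suc j) f                                   ≡⟨ cong (λ m → sumTo (suc m) f) j≡1+h+h ⟩
  sumTo (suc (h ℕ.+ h)) f + f (suc (h ℕ.+ h))       ≡⟨ cong (sumTo (suc (h ℕ.+ h)) f +_) (*-twiceIfEven-odd (g (suc (h ℕ.+ h))) h) ⟩
  sumTo (suc (h ℕ.+ h)) f + 0ℚ                      ≡⟨ ℚₚ.+-identityʳ _ ⟩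
  sumTo (suc (h ℕ.+ h)) f                           ≡⟨ sumTo-twiceIfEven-even h g ⟩
  ℕ→ℚ 2 * sumTo (suc h) (λ l → g (l ℕ.+ l))         ∎
  where
  open ≡-Reasoning
  h = j ℕ./ 2
  f = λ i → g i * twiceIfEven i

twiceIfZero : ℕ → ℚ
twiceIfZero zero    = ℕ→ℚ 2
twiceIfZero (suc _) = 0ℚ

appell-euler-±1 : ∀ j → appell j euler (- 1ℚ) + appell j euler 1ℚ ≡ twiceIfZero j
appell-euler-±1 zero    = refl
appell-euler-±1 (suc k) = begin
  appell j euler (- 1ℚ) + appell j euler 1ℚ
    ≡⟨ sumTo-+ (suc j) _ _ ⟨
  sumTo (suc j) (λ i → Cℚ j i * (- 1ℚ) ^ℚ (j ∸ i) * euler i + Cℚ j i * 1ℚ ^ℚ (j ∸ i) * euler i)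
    ≡⟨ sumTo-cong (suc j) (λ i _ → collect i) ⟩
  sumTo (suc j) (λ i → Cℚ j i * euler i * twiceIfEven (j ∸ i))
    ≡⟨ sumTo-reverse j _ ⟩
  sumTo (suc j) (λ i → Cℚ j (j ∸ i) * euler (j ∸ i) * twiceIfEven (j ∸ (j ∸ i)))
    ≡⟨ sumTo-cong (suc j) (λ i i≤j → reflect i (ℕₚ.≤-pred i≤j)) ⟩
  sumTo (suc j) (λ i → g i * twiceIfEven i)
    ≡⟨ sumTo-twiceIfEven j g ⟩
  ℕ→ℚ 2 * sumTo (suc (j ℕ./ 2)) (λ l → g (l ℕ.+ l))
    ≡⟨ cong (ℕ→ℚ 2 *_) (sumTo-suc-head (j ℕ./ 2) _) ⟩
  ℕ→ℚ 2 * (g 0 + sumTo (j ℕ./ 2) (λ l → g (suc l ℕ.+ suc l)))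
    ≡⟨ cong (λ w → ℕ→ℚ 2 * (g 0 + w)) (sumTo-cong (j ℕ./ 2) (λ l _ → cong (λ m → g (suc l ℕ.+ m)) (sym (ℕₚ.+-identityʳ (suc l))))) ⟩
  ℕ→ℚ 2 * (g 0 + sumTo (j ℕ./ 2) (λ l → g (2 ℕ.* suc l)))
    ≡⟨ cong (λ e → ℕ→ℚ 2 * (1ℚ * e + S)) (euler-suc k) ⟩
  ℕ→ℚ 2 * (1ℚ * - S + S)
    ≡⟨ cancel (ℕ→ℚ 2) S ⟩
  0ℚ ∎
  where
  open ≡-Reasoning
  j = suc k
  g = λ i → Cℚ j i * euler (j ∸ i)
  S = sumTo (j ℕ./ 2) (λ l → g (2 ℕ.* suc l))
  collect : ∀ i → Cℚ j i * (- 1ℚ) ^ℚ (j ∸ i) * euler i + Cℚ j i * 1ℚ ^ℚ (j ∸ i) * euler i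
                ≡ Cℚ j i * euler i * twiceIfEven (j ∸ i)
  collect i = trans (cong (λ w → Cℚ j i * (- 1ℚ) ^ℚ (j ∸ i) * euler i + Cℚ j i * w * euler i) (1^ (j ∸ i)))
                    (factor (Cℚ j i) ((- 1ℚ) ^ℚ (j ∸ i)) (euler i))
    where
    factor : ∀ c s e → c * s * e + c * 1ℚ * e ≡ c * e * (s + 1ℚ)
    factor = solve-∀ ℚ-ring
  reflect : ∀ i → i ≤ j → Cℚ j (j ∸ i) * euler (j ∸ i) * twiceIfEven (j ∸ (j ∸ i)) ≡ g i * twiceIfEven i
  reflect i i≤j = cong₂ (λ c m → ℕ→ℚ c * euler (j ∸ i) * twiceIfEven m)
                        (sym (nCk≡nC[n∸k] i≤j)) (ℕₚ.m∸[m∸n]≡n i≤j)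
  cancel : ∀ t S → t * (1ℚ * - S + S) ≡ 0ℚ
  cancel = solve-∀ ℚ-ring

appell-twiceIfZero : ∀ n w → appell n twiceIfZero w ≡ ℕ→ℚ 2 * w ^ℚ n
appell-twiceIfZero n w = begin
  appell n twiceIfZero w
    ≡⟨ sumTo-suc-head n _ ⟩
  1ℚ * w ^ℚ n * ℕ→ℚ 2 + sumTo n (λ k → Cℚ n (suc k) * w ^ℚ (n ∸ suc k) * 0ℚ)
    ≡⟨ cong (1ℚ * w ^ℚ n * ℕ→ℚ 2 +_) (sumTo-zeros n (λ k _ → ℚₚ.*-zeroʳ (Cℚ n (suc k) * w ^ℚ (n ∸ suc k)))) ⟩
  1ℚ * w ^ℚ n * ℕ→ℚ 2 + 0ℚ
    ≡⟨ simplify (w ^ℚ n) ⟩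
  ℕ→ℚ 2 * w ^ℚ n ∎
  where
  open ≡-Reasoning
  simplify : ∀ W → 1ℚ * W * ℕ→ℚ 2 + 0ℚ ≡ ℕ→ℚ 2 * W
  simplify = solve-∀ ℚ-ring

1/2^ : ℕ → ℚ
1/2^ n = (1/ℕ (2 ℕ.^ n)) {{ℕₚ.m^n≢0 2 n}}

eulerPoly-+1 : ∀ n x → eulerPoly n x + eulerPoly n (x + 1ℚ) ≡ ℕ→ℚ 2 * x ^ℚ n
eulerPoly-+1 n x = begin
  1/2^ n * appell n euler (w - 1ℚ) + 1/2^ n * appell n euler (ℕ→ℚ 2 * (x + 1ℚ) - 1ℚ)
    ≡⟨ cong (λ v → 1/2^ n * appell n euler (w - 1ℚ) + 1/2^ n * appell n euler v) (shift-by-2 x) ⟩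
  1/2^ n * appell n euler (w - 1ℚ) + 1/2^ n * appell n euler (w + 1ℚ)
    ≡⟨ cong₂ (λ a b → 1/2^ n * a + 1/2^ n * b) (appell-shift n euler w (- 1ℚ)) (appell-shift n euler w 1ℚ) ⟩
  1/2^ n * appell n A₋ w + 1/2^ n * appell n A₊ w
    ≡⟨ factor (1/2^ n) (appell n A₋ w) (appell n A₊ w) ⟩
  1/2^ n * (1ℚ * appell n A₋ w + appell n A₊ w)
    ≡⟨ cong (1/2^ n *_) (appell-linear n 1ℚ A₋ A₊ w) ⟨
  1/2^ n * appell n (λ j → 1ℚ * A₋ j + A₊ j) w
    ≡⟨ cong (1/2^ n *_) (appell-cong n w (λ j _ → trans (cong (_+ A₊ j) (ℚₚ.*-identityˡ (A₋ j))) (appell-euler-±1 j))) ⟩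
  1/2^ n * appell n twiceIfZero w
    ≡⟨ cong (1/2^ n *_) (appell-twiceIfZero n w) ⟩
  1/2^ n * (ℕ→ℚ 2 * w ^ℚ n)
    ≡⟨ cong (λ v → 1/2^ n * (ℕ→ℚ 2 * v)) (trans (*-^ (ℕ→ℚ 2) x n) (cong (_* x ^ℚ n) (sym (ℕ→ℚ-^ 2 n)))) ⟩
  1/2^ n * (ℕ→ℚ 2 * (ℕ→ℚ (2 ℕ.^ n) * x ^ℚ n))
    ≡⟨ regroup (1/2^ n) (ℕ→ℚ 2) (ℕ→ℚ (2 ℕ.^ n)) (x ^ℚ n) ⟩
  (ℕ→ℚ (2 ℕ.^ n) * 1/2^ n) * (ℕ→ℚ 2 * x ^ℚ n)
    ≡⟨ cong (_* (ℕ→ℚ 2 * x ^ℚ n)) (ℕ→ℚ-*-1/ℕ (2 ℕ.^ n) {{ℕₚ.m^n≢0 2 n}}) ⟩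
  1ℚ * (ℕ→ℚ 2 * x ^ℚ n)
    ≡⟨ ℚₚ.*-identityˡ _ ⟩
  ℕ→ℚ 2 * x ^ℚ n ∎
  where
  open ≡-Reasoning
  w = ℕ→ℚ 2 * x
  A₋ = λ j → appell j euler (- 1ℚ)
  A₊ = λ j → appell j euler 1ℚ
  shift-by-2 : ∀ x → ℕ→ℚ 2 * (x + 1ℚ) - 1ℚ ≡ ℕ→ℚ 2 * x + 1ℚ
  shift-by-2 = solve-∀ ℚ-ring
  factor : ∀ i a b → i * a + i * b ≡ i * (1ℚ * a + b)
  factor = solve-∀ ℚ-ring
  regroup : ∀ i t N X → i * (t * (N * X)) ≡ (N * i) * (t * X)
  regroup = solve-∀ ℚ-ring

-- p-integral rationals and congruences modulo M ℤ₍ₚ₎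

↧ₙ-/-∣ : ∀ i d .{{_ : ℕ.NonZero d}} → ↧ₙ (i / d) ∣ d
↧ₙ-/-∣ i d = divides ℤ.∣ gcd i (ℤ.+ d) ∣ (begin
  d                                    ≡⟨ cong ℤ.∣_∣ (ℚₚ.↧-/ i d) ⟨
  ℤ.∣ ↧ (i / d) ℤ.* gcd i (ℤ.+ d) ∣    ≡⟨ ℤₚ.abs-* (↧ (i / d)) (gcd i (ℤ.+ d)) ⟩
  ↧ₙ (i / d) ℕ.* ℤ.∣ gcd i (ℤ.+ d) ∣   ≡⟨ ℕₚ.*-comm (↧ₙ (i / d)) _ ⟩
  ℤ.∣ gcd i (ℤ.+ d) ∣ ℕ.* ↧ₙ (i / d)   ∎)
  where open ≡-Reasoning

module Localisation (p : ℕ) (p-prime : Prime p) where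

  p∤1 : ¬ p ∣ 1
  p∤1 p∣1 = ¬prime[1] (subst Prime (∣1⇒≡1 p∣1) p-prime)

  p∤* : ∀ {m n} → ¬ p ∣ m → ¬ p ∣ n → ¬ p ∣ m ℕ.* n
  p∤* {m} {n} p∤m p∤n p∣mn with euclidsLemma m n p-prime p∣mn
  ... | inj₁ p∣m = p∤m p∣m
  ... | inj₂ p∣n = p∤n p∣n

  p∤< : ∀ {k} → 0 < k → k < p → ¬ p ∣ k
  p∤< {suc k} _ k<p p∣k = ℕₚ.<⇒≱ k<p (∣⇒≤ p∣k)

  p∤! : ∀ {k} → k < p → ¬ p ∣ k !
  p∤! {zero}  _     = p∤1
  p∤! {suc k} 1+k<p = p∤* (p∤< (ℕ.s≤s ℕ.z≤n) 1+k<p) (p∤! (ℕₚ.<-trans (ℕₚ.n<1+n k) 1+k<p))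

  record Integral (x : ℚ) : Set where
    constructor integral
    field p∤denominator : InZp p x
  open Integral public

  integral-/ : ∀ i d .{{_ : ℕ.NonZero d}} → ¬ p ∣ d → Integral (i / d)
  integral-/ i d p∤d = integral (λ p∣↧ → p∤d (∣-trans p∣↧ (↧ₙ-/-∣ i d)))

  integral-+ : ∀ {x y} → Integral x → Integral y → Integral (x + y)
  integral-+ {x@record{}} {y@record{}} (integral p∤↧x) (integral p∤↧y) =
    integral-/ (↥ x ℤ.* ↧ y ℤ.+ ↥ y ℤ.* ↧ x) (↧ₙ x ℕ.* ↧ₙ y) (p∤* p∤↧x p∤↧y)

  integral-* : ∀ {x y} → Integral x → Integral y → Integral (x * y)
  integral-* {x@record{}} {y@record{}} (integral p∤↧x) (integral p∤↧y) =
    integral-/ (↥ x ℤ.* ↥ y) (↧ₙ x ℕ.* ↧ₙ y) (p∤* p∤↧x p∤↧y)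

  integral-neg : ∀ {x} → Integral x → Integral (- x)
  integral-neg {x} (integral p∤↧x) = integral (λ p∣↧ → p∤↧x (subst (p ∣_) (ℤₚ.+-injective (ℚₚ.↧-neg x)) p∣↧))

  integral-- : ∀ {x y} → Integral x → Integral y → Integral (x - y)
  integral-- ix iy = integral-+ ix (integral-neg iy)

  integral-ℕ : ∀ n → Integral (ℕ→ℚ n)
  integral-ℕ n = integral-/ (ℤ.+ n) 1 p∤1

  integral-1/ℕ : ∀ k .{{_ : ℕ.NonZero k}} → ¬ p ∣ k → Integral (1/ℕ k)
  integral-1/ℕ k = integral-/ (ℤ.+ 1) k

  integral-^ : ∀ {x} k → Integral x → Integral (x ^ℚ k)
  integral-^ zero    ix = integral-ℕ 1
  integral-^ (suc k) ix = integral-* ix (integral-^ k ix)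

  integral-sumTo : ∀ n {f : ℕ → ℚ} → (∀ k → k < n → Integral (f k)) → Integral (sumTo n f)
  integral-sumTo zero    if = integral-ℕ 0
  integral-sumTo (suc n) if = integral-+ (integral-sumTo n (λ k k<n → if k (ℕₚ.m<n⇒m<1+n k<n))) (if n ℕₚ.≤-refl)

  integral-falling : ∀ {x} k → Integral x → Integral (falling x k)
  integral-falling zero    ix = integral-ℕ 1
  integral-falling (suc k) ix = integral-* (integral-falling k ix) (integral-- ix (integral-ℕ k))

  integral-1/[!] : ∀ {k} → k < p → Integral 1/[ k !]
  integral-1/[!] {k} k<p = integral-/ (ℤ.+ 1) (k !) {{k ℕₚ.!≢0}} (p∤! k<p)

  integral-binomℚ : ∀ {x} k → k < p → Integral x → Integral (binomℚ x k)
  integral-binomℚ k k<p ix = integral-* (integral-falling k ix) (integral-1/[!] k<p)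

  integral-−1 : Integral (- 1ℚ)
  integral-−1 = integral-neg (integral-ℕ 1)

  infix 4 _≈_[mod_]

  record _≈_[mod_] (x y M : ℚ) : Set where
    constructor quotient-by
    field
      quotient          : ℚ
      integral-quotient : Integral quotient
      difference        : x - y ≡ M * quotient

  module _ {M : ℚ} where

    ≈-reflexive : ∀ {x y} → x ≡ y → x ≈ y [mod M ]
    ≈-reflexive {x} refl = quotient-by 0ℚ (integral-ℕ 0) (trans (ℚₚ.+-inverseʳ x) (sym (ℚₚ.*-zeroʳ M)))

    ≈-refl : ∀ {x} → x ≈ x [mod M ]
    ≈-refl = ≈-reflexive refl

    ≈-sym : ∀ {x y} → x ≈ y [mod M ] → y ≈ x [mod M ]
    ≈-sym {x} {y} (quotient-by q iq x-y≡Mq) = quotient-by (- q) (integral-neg iq) (begin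
      y - x        ≡⟨ swap x y ⟩
      - (x - y)    ≡⟨ cong -_ x-y≡Mq ⟩
      - (M * q)    ≡⟨ ℚₚ.neg-distribʳ-* M q ⟩
      M * - q      ∎)
      where
      open ≡-Reasoning
      swap : ∀ x y → y - x ≡ - (x - y)
      swap = solve-∀ ℚ-ring

    ≈-trans : ∀ {x y z} → x ≈ y [mod M ] → y ≈ z [mod M ] → x ≈ z [mod M ]
    ≈-trans {x} {y} {z} (quotient-by q iq x-y≡Mq) (quotient-by r ir y-z≡Mr) =
      quotient-by (q + r) (integral-+ iq ir) (begin
        x - z                ≡⟨ telescope x y z ⟩
        (x - y) + (y - z)    ≡⟨ cong₂ _+_ x-y≡Mq y-z≡Mr ⟩
        M * q + M * r        ≡⟨ ℚₚ.*-distribˡ-+ M q r ⟨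
        M * (q + r)          ∎)
      where
      open ≡-Reasoning
      telescope : ∀ x y z → x - z ≡ (x - y) + (y - z)
      telescope = solve-∀ ℚ-ring

    +-cong : ∀ {x x′ y y′} → x ≈ x′ [mod M ] → y ≈ y′ [mod M ] → x + y ≈ x′ + y′ [mod M ]
    +-cong {x} {x′} {y} {y′} (quotient-by q iq x-x′≡Mq) (quotient-by r ir y-y′≡Mr) =
      quotient-by (q + r) (integral-+ iq ir) (begin
        (x + y) - (x′ + y′)      ≡⟨ interchange x x′ y y′ ⟩
        (x - x′) + (y - y′)      ≡⟨ cong₂ _+_ x-x′≡Mq y-y′≡Mr ⟩
        M * q + M * r            ≡⟨ ℚₚ.*-distribˡ-+ M q r ⟨
        M * (q + r)              ∎)
      where
      open ≡-Reasoning
      interchange : ∀ x x′ y y′ → (x + y) - (x′ + y′) ≡ (x - x′) + (y - y′)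
      interchange = solve-∀ ℚ-ring

    *-congˡ : ∀ {c x y} → Integral c → x ≈ y [mod M ] → c * x ≈ c * y [mod M ]
    *-congˡ {c} {x} {y} ic (quotient-by q iq x-y≡Mq) = quotient-by (c * q) (integral-* ic iq) (begin
      c * x - c * y    ≡⟨ factor c x y ⟩
      c * (x - y)      ≡⟨ cong (c *_) x-y≡Mq ⟩
      c * (M * q)      ≡⟨ swap c M q ⟩
      M * (c * q)      ∎)
      where
      open ≡-Reasoning
      factor : ∀ c x y → c * x - c * y ≡ c * (x - y)
      factor = solve-∀ ℚ-ring
      swap : ∀ c M q → c * (M * q) ≡ M * (c * q)
      swap = solve-∀ ℚ-ring

    *-congʳ : ∀ {c x y} → Integral c → x ≈ y [mod M ] → x * c ≈ y * c [mod M ]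
    *-congʳ {c} {x} {y} ic x≈y =
      subst₂ _≈_[mod M ] (ℚₚ.*-comm c x) (ℚₚ.*-comm c y) (*-congˡ ic x≈y)

    neg-cong : ∀ {x y} → x ≈ y [mod M ] → - x ≈ - y [mod M ]
    neg-cong {x} {y} (quotient-by q iq x-y≡Mq) = quotient-by (- q) (integral-neg iq) (begin
      - x - - y        ≡⟨ factor x y ⟩
      - (x - y)        ≡⟨ cong -_ x-y≡Mq ⟩
      - (M * q)        ≡⟨ ℚₚ.neg-distribʳ-* M q ⟩
      M * - q          ∎)
      where
      open ≡-Reasoning
      factor : ∀ x y → - x - - y ≡ - (x - y)
      factor = solve-∀ ℚ-ring

    −-cong : ∀ {x x′ y y′} → x ≈ x′ [mod M ] → y ≈ y′ [mod M ] → x - y ≈ x′ - y′ [mod M ]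
    −-cong x≈x′ y≈y′ = +-cong x≈x′ (neg-cong y≈y′)

    *-cong : ∀ {x x′ y y′} → Integral x → Integral y′ →
             x ≈ x′ [mod M ] → y ≈ y′ [mod M ] → x * y ≈ x′ * y′ [mod M ]
    *-cong {x} {x′} {y} {y′} ix iy′ (quotient-by q iq x-x′≡Mq) (quotient-by r ir y-y′≡Mr) =
      quotient-by (x * r + q * y′) (integral-+ (integral-* ix ir) (integral-* iq iy′)) (begin
        x * y - x′ * y′                  ≡⟨ split x x′ y y′ ⟩
        x * (y - y′) + (x - x′) * y′     ≡⟨ cong₂ (λ a b → x * a + b * y′) y-y′≡Mr x-x′≡Mq ⟩
        x * (M * r) + (M * q) * y′       ≡⟨ factor M x y′ q r ⟩
        M * (x * r + q * y′)             ∎)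
      where
      open ≡-Reasoning
      split : ∀ x x′ y y′ → x * y - x′ * y′ ≡ x * (y - y′) + (x - x′) * y′
      split = solve-∀ ℚ-ring
      factor : ∀ M x y′ q r → x * (M * r) + (M * q) * y′ ≡ M * (x * r + q * y′)
      factor = solve-∀ ℚ-ring

    ^-cong : ∀ {x x′} k → Integral x → Integral x′ → x ≈ x′ [mod M ] → x ^ℚ k ≈ x′ ^ℚ k [mod M ]
    ^-cong zero    ix ix′ x≈x′ = ≈-refl
    ^-cong (suc k) ix ix′ x≈x′ = *-cong ix (integral-^ k ix′) x≈x′ (^-cong k ix ix′ x≈x′)

    falling-cong : ∀ {x x′} k → Integral x → Integral x′ → x ≈ x′ [mod M ] → falling x k ≈ falling x′ k [mod M ]
    falling-cong zero    ix ix′ x≈x′ = ≈-refl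
    falling-cong (suc k) ix ix′ x≈x′ =
      *-cong (integral-falling k ix) (integral-- ix′ (integral-ℕ k)) (falling-cong k ix ix′ x≈x′) (−-cong x≈x′ ≈-refl)

    sumTo-congₘ : ∀ n {f g : ℕ → ℚ} → (∀ k → k < n → f k ≈ g k [mod M ]) → sumTo n f ≈ sumTo n g [mod M ]
    sumTo-congₘ zero    f≈g = ≈-refl
    sumTo-congₘ (suc n) f≈g = +-cong (sumTo-congₘ n (λ k k<n → f≈g k (ℕₚ.m<n⇒m<1+n k<n))) (f≈g n ℕₚ.≤-refl)

    mod-*-weaken : ∀ {c x y} → Integral c → x ≈ y [mod M * c ] → x ≈ y [mod M ]
    mod-*-weaken {c} ic (quotient-by q iq x-y≡Mcq) =
      quotient-by (c * q) (integral-* ic iq) (trans x-y≡Mcq (ℚₚ.*-assoc M c q))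

    mod-scale : ∀ {N x y} → x ≈ y [mod M ] → N * x ≈ N * y [mod N * M ]
    mod-scale {N} {x} {y} (quotient-by q iq x-y≡Mq) = quotient-by q iq (begin
      N * x - N * y    ≡⟨ factor N x y ⟩
      N * (x - y)      ≡⟨ cong (N *_) x-y≡Mq ⟩
      N * (M * q)      ≡⟨ ℚₚ.*-assoc N M q ⟨
      N * M * q        ∎)
      where
      open ≡-Reasoning
      factor : ∀ N x y → N * x - N * y ≡ N * (x - y)
      factor = solve-∀ ℚ-ring

    mod-unscale : ∀ {N N⁻¹ x y} → N⁻¹ * N ≡ 1ℚ → N * x ≈ N * y [mod N * M ] → x ≈ y [mod M ]
    mod-unscale {N} {N⁻¹} {x} {y} N⁻¹N≡1 (quotient-by q iq Nx-Ny≡NMq) = quotient-by q iq (begin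
      x - y                    ≡⟨ ℚₚ.*-identityˡ (x - y) ⟨
      1ℚ * (x - y)             ≡⟨ cong (_* (x - y)) N⁻¹N≡1 ⟨
      N⁻¹ * N * (x - y)        ≡⟨ factor N⁻¹ N x y ⟩
      N⁻¹ * (N * x - N * y)    ≡⟨ cong (N⁻¹ *_) Nx-Ny≡NMq ⟩
      N⁻¹ * (N * M * q)        ≡⟨ regroup N⁻¹ N M q ⟩
      N⁻¹ * N * (M * q)        ≡⟨ cong (_* (M * q)) N⁻¹N≡1 ⟩
      1ℚ * (M * q)             ≡⟨ ℚₚ.*-identityˡ (M * q) ⟩
      M * q                    ∎)
      where
      open ≡-Reasoning
      factor : ∀ N⁻¹ N x y → N⁻¹ * N * (x - y) ≡ N⁻¹ * (N * x - N * y)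
      factor = solve-∀ ℚ-ring
      regroup : ∀ N⁻¹ N M q → N⁻¹ * (N * M * q) ≡ N⁻¹ * N * (M * q)
      regroup = solve-∀ ℚ-ring

    ≈-1/ℕ : ∀ {k x} .{{_ : ℕ.NonZero k}} → ¬ p ∣ k → x * ℕ→ℚ k ≈ 1ℚ [mod M ] → x ≈ 1/ℕ k [mod M ]
    ≈-1/ℕ {k} {x} p∤k xk≈1 = ≈-trans (≈-reflexive x≡xk/k) (≈-trans (*-congˡ (integral-1/ℕ k p∤k) xk≈1)
                                                            (≈-reflexive (ℚₚ.*-identityʳ (1/ℕ k))))
      where
      x≡xk/k : x ≡ 1/ℕ k * (x * ℕ→ℚ k)
      x≡xk/k = begin
        x                          ≡⟨ ℚₚ.*-identityʳ x ⟨
        x * 1ℚ                     ≡⟨ cong (x *_) (ℕ→ℚ-*-1/ℕ k) ⟨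
        x * (ℕ→ℚ k * 1/ℕ k)        ≡⟨ ℚₚ.*-assoc x (ℕ→ℚ k) (1/ℕ k) ⟨
        x * ℕ→ℚ k * 1/ℕ k          ≡⟨ ℚₚ.*-comm (x * ℕ→ℚ k) (1/ℕ k) ⟩
        1/ℕ k * (x * ℕ→ℚ k)        ∎
        where open ≡-Reasoning

  ≈-setoid : ℚ → Setoid 0ℓ 0ℓ
  ≈-setoid M = record
    { Carrier       = ℚ
    ; _≈_           = _≈_[mod M ]
    ; isEquivalence = record { refl = ≈-refl ; sym = ≈-sym ; trans = ≈-trans }
    }

  module ≈-Reasoning (M : ℚ) = SetoidReasoning (≈-setoid M)

  fromCongMod : ∀ {m x y} → CongMod p m x y → x ≈ y [mod ℕ→ℚ (p ℕ.^ m) ]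
  fromCongMod (q , p∤↧q , x-y≡pᵐq) = quotient-by q (integral p∤↧q) x-y≡pᵐq

  toCongMod : ∀ {m x y} → x ≈ y [mod ℕ→ℚ (p ℕ.^ m) ] → CongMod p m x y
  toCongMod (quotient-by q (integral p∤↧q) x-y≡pᵐq) = q , p∤↧q , x-y≡pᵐq

-- The argument at a fixed prime

-- The prime is written p = n + 2, so that the exponent p ∸ 2 of the statement is n.
module AtPrime (n : ℕ) (p-prime : Prime (suc (suc n))) (3<p : 3 < suc (suc n)) where

  p : ℕ
  p = suc (suc n)

  P P² : ℚ
  P  = ℕ→ℚ p
  P² = P * P

  open Localisation p p-prime

  n-odd : n ≡ suc (n ℕ./ 2 ℕ.+ n ℕ./ 2)
  n-odd with even⊎odd n
  ... | inj₂ n≡1+h+h = n≡1+h+h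
  ... | inj₁ n≡h+h with prime⇒irreducible p-prime (divides (suc (n ℕ./ 2)) p≡[1+h]*2)
    where
    p≡[1+h]*2 : p ≡ suc (n ℕ./ 2) ℕ.* 2
    p≡[1+h]*2 = trans (cong (λ m → suc (suc m)) n≡h+h) (double (n ℕ./ 2))
      where
      double : ∀ h → suc (suc (h ℕ.+ h)) ≡ suc h ℕ.* 2
      double h = cong (λ m → suc (suc m)) (trans (cong (h ℕ.+_) (sym (ℕₚ.+-identityʳ h))) (ℕₚ.*-comm 2 h))
  ...   | inj₁ ()
  ...   | inj₂ 2≡p = contradiction 3<p (ℕₚ.<-asym (subst (_< 3) 2≡p ℕₚ.≤-refl))

  p∤2 : ¬ p ∣ 2
  p∤2 = p∤< (ℕ.s≤s ℕ.z≤n) (ℕₚ.<-trans (ℕₚ.n<1+n 2) 3<p)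

  p∤1+ : ∀ {k} → k < suc n → ¬ p ∣ suc k
  p∤1+ k<1+n = p∤< (ℕ.s≤s ℕ.z≤n) (ℕ.s≤s k<1+n)

  -1^p-1 : (- 1ℚ) ^ℚ suc n ≡ 1ℚ
  -1^p-1 = trans (cong (λ m → (- 1ℚ) ^ℚ suc m) n-odd) (cong ((- 1ℚ) *_) (-1^-odd (n ℕ./ 2)))

  -1^p : (- 1ℚ) ^ℚ p ≡ - 1ℚ
  -1^p = trans (cong ((- 1ℚ) *_) -1^p-1) (ℚₚ.*-identityʳ (- 1ℚ))

  ^p-neg : ∀ x → (- x) ^ℚ p ≡ - (x ^ℚ p)
  ^p-neg x = begin
    (- x) ^ℚ p               ≡⟨ ^-neg x p ⟩
    (- 1ℚ) ^ℚ p * x ^ℚ p     ≡⟨ cong (_* x ^ℚ p) -1^p ⟩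
    - 1ℚ * x ^ℚ p            ≡⟨ ℚₚ.neg-distribˡ-* 1ℚ (x ^ℚ p) ⟨
    - (1ℚ * x ^ℚ p)          ≡⟨ cong -_ (ℚₚ.*-identityˡ (x ^ℚ p)) ⟩
    - (x ^ℚ p)               ∎
    where open ≡-Reasoning

  ^n-neg : ∀ x → (- x) ^ℚ n ≡ - (x ^ℚ n)
  ^n-neg x = begin
    (- x) ^ℚ n                                ≡⟨ cong ((- x) ^ℚ_) n-odd ⟩
    (- x) ^ℚ suc (n ℕ./ 2 ℕ.+ n ℕ./ 2)        ≡⟨ ^-neg-odd x (n ℕ./ 2) ⟩
    - (x ^ℚ suc (n ℕ./ 2 ℕ.+ n ℕ./ 2))        ≡⟨ cong (λ m → - (x ^ℚ m)) n-odd ⟨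
    - (x ^ℚ n)                                ∎
    where open ≡-Reasoning

  ℕ→ℚ[p^1]≡P : ℕ→ℚ (p ℕ.^ 1) ≡ P
  ℕ→ℚ[p^1]≡P = cong ℕ→ℚ (ℕₚ.^-identityʳ p)

  CongMod¹⇒≈ : ∀ {x y} → CongMod p 1 x y → x ≈ y [mod P ]
  CongMod¹⇒≈ {x} {y} x≡y = subst (x ≈ y [mod_]) ℕ→ℚ[p^1]≡P (fromCongMod {m = 1} x≡y)

  ≈⇒CongMod² : ∀ {x y} → x ≈ y [mod P² ] → CongMod p 2 x y
  ≈⇒CongMod² {x} {y} x≈y = toCongMod {m = 2} (subst (x ≈ y [mod_]) (sym ℕ→ℚ[p^2]≡P²) x≈y)
    where
    ℕ→ℚ[p^2]≡P² : ℕ→ℚ (p ℕ.^ 2) ≡ P²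
    ℕ→ℚ[p^2]≡P² = trans (ℕ→ℚ-* p (p ℕ.^ 1)) (cong (P *_) ℕ→ℚ[p^1]≡P)

  integral-P : Integral P
  integral-P = integral-ℕ p

  multiple-of-P : ∀ {x y t} → Integral t → x - y ≡ P * t → x ≈ y [mod P ]
  multiple-of-P it x-y≡Pt = quotient-by _ it x-y≡Pt

  P*t-1≈-1 : ∀ {t} → Integral t → P * t - 1ℚ ≈ - 1ℚ [mod P ]
  P*t-1≈-1 {t} it = multiple-of-P it (cancel P t)
    where
    cancel : ∀ P t → (P * t - 1ℚ) - - 1ℚ ≡ P * t
    cancel = solve-∀ ℚ-ring

  1+P*t≈1 : ∀ {t} → Integral t → 1ℚ + P * t ≈ 1ℚ [mod P ]
  1+P*t≈1 {t} it = multiple-of-P it (cancel P t)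
    where
    cancel : ∀ P t → (1ℚ + P * t) - 1ℚ ≡ P * t
    cancel = solve-∀ ℚ-ring

  logCoeff : ℕ → ℚ
  logCoeff k = (- 1ℚ) ^ℚ k * 1/ℕ (suc k)

  integral-logCoeff : ∀ k → k < suc n → Integral (logCoeff k)
  integral-logCoeff k k<1+n = integral-* (integral-^ k integral-−1) (integral-1/ℕ (suc k) (p∤1+ k<1+n))

  truncatedLog : ℚ → ℚ
  truncatedLog y = sumTo (suc n) (λ k → logCoeff k * y ^ℚ suc k)

  integral-truncatedLog : ∀ {y} → Integral y → Integral (truncatedLog y)
  integral-truncatedLog iy = integral-sumTo (suc n) (λ k k<1+n → integral-* (integral-logCoeff k k<1+n) (integral-^ (suc k) iy))

  binomℚ-P* : ∀ {t} k → suc k < p → Integral t → binomℚ (P * t) (suc k) ≈ P * (t * logCoeff k) [mod P² ]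
  binomℚ-P* {t} k 1+k<p it = begin
    binomℚ (P * t) (suc k)                             ≡⟨ cong (_* 1/[ suc k !]) (falling-suc-head (P * t) k) ⟩
    P * t * falling (P * t - 1ℚ) k * 1/[ suc k !]      ≡⟨ regroup P t (falling (P * t - 1ℚ) k) 1/[ suc k !] ⟩
    P * (t * 1/[ suc k !] * falling (P * t - 1ℚ) k)    ≈⟨ mod-scale {N = P} (*-congˡ ic P*t-1↦-1) ⟩
    P * (t * 1/[ suc k !] * falling (- 1ℚ) k)          ≡⟨ cong (λ w → P * (t * 1/[ suc k !] * w)) (falling-−1 k) ⟩
    P * (t * 1/[ suc k !] * ((- 1ℚ) ^ℚ k * ℕ→ℚ (k !))) ≡⟨ regroup′ P t 1/[ suc k !] ((- 1ℚ) ^ℚ k) (ℕ→ℚ (k !)) ⟩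
    P * (t * ((- 1ℚ) ^ℚ k * (ℕ→ℚ (k !) * 1/[ suc k !]))) ≡⟨ cong (λ w → P * (t * ((- 1ℚ) ^ℚ k * w))) (!-*-1/[suc!] k) ⟩
    P * (t * logCoeff k)                               ∎
    where
    open ≈-Reasoning P²
    ic : Integral (t * 1/[ suc k !])
    ic = integral-* it (integral-1/[!] 1+k<p)
    P*t-1↦-1 : falling (P * t - 1ℚ) k ≈ falling (- 1ℚ) k [mod P ]
    P*t-1↦-1 = falling-cong k (integral-- (integral-* integral-P it) (integral-ℕ 1)) integral-−1 (P*t-1≈-1 it)
    regroup : ∀ P t F i → P * t * F * i ≡ P * (t * i * F)
    regroup = solve-∀ ℚ-ring
    regroup′ : ∀ P t i s f → P * (t * i * (s * f)) ≡ P * (t * (s * (f * i)))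
    regroup′ = solve-∀ ℚ-ring

  binomialSum-P* : ∀ {t y} → Integral t → Integral y →
                   binomialSum (suc n) (P * t) y ≈ 1ℚ + P * (t * truncatedLog y) [mod P² ]
  binomialSum-P* {t} {y} it iy = begin
    binomialSum (suc n) (P * t) y
      ≡⟨ sumTo-suc-head (suc n) _ ⟩
    1ℚ + sumTo (suc n) (λ k → binomℚ (P * t) (suc k) * y ^ℚ suc k)
      ≈⟨ +-cong (≈-refl {x = 1ℚ}) (sumTo-congₘ (suc n) (λ k k<1+n →
           *-cong (integral-binomℚ (suc k) (ℕ.s≤s k<1+n) (integral-* integral-P it)) (integral-^ (suc k) iy)
                  (binomℚ-P* k (ℕ.s≤s k<1+n) it) ≈-refl)) ⟩
    1ℚ + sumTo (suc n) (λ k → P * (t * logCoeff k) * y ^ℚ suc k)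
      ≡⟨ cong (1ℚ +_) (sumTo-cong (suc n) (λ k _ → regroup P t (logCoeff k) (y ^ℚ suc k))) ⟩
    1ℚ + sumTo (suc n) (λ k → P * t * (logCoeff k * y ^ℚ suc k))
      ≡⟨ cong (1ℚ +_) (trans (*-distribˡ-sumTo (suc n) (P * t) _) (ℚₚ.*-assoc P t (truncatedLog y))) ⟩
    1ℚ + P * (t * truncatedLog y) ∎
    where
    open ≈-Reasoning P²
    regroup : ∀ P t c Y → P * (t * c) * Y ≡ P * t * (c * Y)
    regroup = solve-∀ ℚ-ring

  [1+y]^p-y^p≈ : ∀ {y} → Integral y → (1ℚ + y) ^ℚ p - y ^ℚ p ≈ 1ℚ + P * truncatedLog y [mod P² ]
  [1+y]^p-y^p≈ {y} iy = begin
    (1ℚ + y) ^ℚ p - y ^ℚ p                  ≡⟨ binomialSum-suc-top (suc n) y ⟨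
    binomialSum (suc n) P y                 ≡⟨ cong (λ x → binomialSum (suc n) x y) (ℚₚ.*-identityʳ P) ⟨
    binomialSum (suc n) (P * 1ℚ) y          ≈⟨ binomialSum-P* (integral-ℕ 1) iy ⟩
    1ℚ + P * (1ℚ * truncatedLog y)          ≡⟨ cong (λ w → 1ℚ + P * w) (ℚₚ.*-identityˡ (truncatedLog y)) ⟩
    1ℚ + P * truncatedLog y                 ∎
    where open ≈-Reasoning P²

  frobenius-+1 : ∀ {y} → Integral y → (1ℚ + y) ^ℚ p ≈ y ^ℚ p + 1ℚ [mod P ]
  frobenius-+1 {y} iy = begin
    (1ℚ + y) ^ℚ p                                ≡⟨ move (((1ℚ + y) ^ℚ p)) (y ^ℚ p) ⟩
    ((1ℚ + y) ^ℚ p - y ^ℚ p) + y ^ℚ p            ≈⟨ +-cong (mod-*-weaken integral-P ([1+y]^p-y^p≈ iy)) (≈-refl {x = y ^ℚ p}) ⟩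
    (1ℚ + P * truncatedLog y) + y ^ℚ p           ≈⟨ +-cong (1+P*t≈1 (integral-truncatedLog iy)) (≈-refl {x = y ^ℚ p}) ⟩
    1ℚ + y ^ℚ p                                  ≡⟨ ℚₚ.+-comm 1ℚ (y ^ℚ p) ⟩
    y ^ℚ p + 1ℚ                                  ∎
    where
    open ≈-Reasoning P
    move : ∀ a b → a ≡ (a - b) + b
    move = solve-∀ ℚ-ring

  fermat : ∀ m → ℕ→ℚ m ^ℚ p ≈ ℕ→ℚ m [mod P ]
  fermat zero    = ≈-reflexive (0^-suc (suc n))
  fermat (suc m) = begin
    ℕ→ℚ (suc m) ^ℚ p      ≡⟨ cong (_^ℚ p) (trans (ℕ→ℚ-suc m) (ℚₚ.+-comm (ℕ→ℚ m) 1ℚ)) ⟩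
    (1ℚ + ℕ→ℚ m) ^ℚ p     ≈⟨ frobenius-+1 (integral-ℕ m) ⟩
    ℕ→ℚ m ^ℚ p + 1ℚ       ≈⟨ +-cong (fermat m) (≈-refl {x = 1ℚ}) ⟩
    ℕ→ℚ m + 1ℚ            ≡⟨ ℕ→ℚ-suc m ⟨
    ℕ→ℚ (suc m)           ∎
    where open ≈-Reasoning P

  fermat-inverse : ∀ m .{{_ : ℕ.NonZero m}} → m < p → ℕ→ℚ m ^ℚ n ≈ 1/ℕ m [mod P ]
  fermat-inverse m m<p = begin
    x ^ℚ n                       ≡⟨ ℚₚ.*-identityˡ (x ^ℚ n) ⟨
    1ℚ * x ^ℚ n                  ≡⟨ cong (λ w → w * w * x ^ℚ n) x*x⁻¹≡1 ⟨
    (x * x⁻¹) * (x * x⁻¹) * x ^ℚ n ≡⟨ regroup x x⁻¹ (x ^ℚ n) ⟩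
    (x⁻¹ * x⁻¹) * x ^ℚ p         ≈⟨ *-congˡ (integral-* ix⁻¹ ix⁻¹) (fermat m) ⟩
    (x⁻¹ * x⁻¹) * x              ≡⟨ regroup′ x x⁻¹ ⟩
    (x * x⁻¹) * x⁻¹              ≡⟨ cong (_* x⁻¹) x*x⁻¹≡1 ⟩
    1ℚ * x⁻¹                     ≡⟨ ℚₚ.*-identityˡ x⁻¹ ⟩
    x⁻¹                          ∎
    where
    open ≈-Reasoning P
    x = ℕ→ℚ m
    x⁻¹ = 1/ℕ m
    ix⁻¹ : Integral x⁻¹
    ix⁻¹ = integral-1/ℕ m (p∤< (ℕₚ.n≢0⇒n>0 (ℕ.≢-nonZero⁻¹ m)) m<p)
    x*x⁻¹≡1 : x * x⁻¹ ≡ 1ℚ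
    x*x⁻¹≡1 = ℕ→ℚ-*-1/ℕ m
    regroup : ∀ x i X → (x * i) * (x * i) * X ≡ (i * i) * (x * (x * X))
    regroup = solve-∀ ℚ-ring
    regroup′ : ∀ x i → (i * i) * x ≡ (x * i) * i
    regroup′ = solve-∀ ℚ-ring

  [1-2]^p-[-2]^p≡[1+1]^p-1^p : (1ℚ + - ℕ→ℚ 2) ^ℚ p - (- ℕ→ℚ 2) ^ℚ p ≡ (1ℚ + 1ℚ) ^ℚ p - 1ℚ ^ℚ p
  [1-2]^p-[-2]^p≡[1+1]^p-1^p = begin
    (1ℚ + - ℕ→ℚ 2) ^ℚ p - (- ℕ→ℚ 2) ^ℚ p     ≡⟨ cong₂ _-_ -1^p (^p-neg (ℕ→ℚ 2)) ⟩
    - 1ℚ - - (ℕ→ℚ 2 ^ℚ p)                     ≡⟨ swap (ℕ→ℚ 2 ^ℚ p) ⟩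
    ℕ→ℚ 2 ^ℚ p - 1ℚ                           ≡⟨ cong (λ w → ℕ→ℚ 2 ^ℚ p - w) (1^ p) ⟨
    (1ℚ + 1ℚ) ^ℚ p - 1ℚ ^ℚ p                  ∎
    where
    open ≡-Reasoning
    swap : ∀ a → - 1ℚ - - a ≡ a - 1ℚ
    swap = solve-∀ ℚ-ring

  -- Both sides come from (1 + y)^p - y^p, which is 2^p - 1 at y = -2 and at y = 1.
  truncatedLog-−2≈1 : truncatedLog (- ℕ→ℚ 2) ≈ truncatedLog 1ℚ [mod P ]
  truncatedLog-−2≈1 = mod-unscale {N = P} {N⁻¹ = 1/ℕ p} P⁻¹P≡1 (begin
    P * truncatedLog (- ℕ→ℚ 2)                    ≡⟨ cancel-1 (P * truncatedLog (- ℕ→ℚ 2)) ⟩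
    (1ℚ + P * truncatedLog (- ℕ→ℚ 2)) - 1ℚ        ≈⟨ −-cong (≈-sym ([1+y]^p-y^p≈ (integral-neg (integral-ℕ 2)))) (≈-refl {x = 1ℚ}) ⟩
    ((1ℚ + - ℕ→ℚ 2) ^ℚ p - (- ℕ→ℚ 2) ^ℚ p) - 1ℚ   ≡⟨ cong (λ w → w - 1ℚ) [1-2]^p-[-2]^p≡[1+1]^p-1^p ⟩
    ((1ℚ + 1ℚ) ^ℚ p - 1ℚ ^ℚ p) - 1ℚ               ≈⟨ −-cong ([1+y]^p-y^p≈ (integral-ℕ 1)) (≈-refl {x = 1ℚ}) ⟩
    (1ℚ + P * truncatedLog 1ℚ) - 1ℚ               ≡⟨ cancel-1 (P * truncatedLog 1ℚ) ⟨
    P * truncatedLog 1ℚ                           ∎)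
    where
    open ≈-Reasoning P²
    P⁻¹P≡1 : 1/ℕ p * P ≡ 1ℚ
    P⁻¹P≡1 = trans (ℚₚ.*-comm (1/ℕ p) P) (ℕ→ℚ-*-1/ℕ p)
    cancel-1 : ∀ a → a ≡ (1ℚ + a) - 1ℚ
    cancel-1 = solve-∀ ℚ-ring

  P*t+x≈x : ∀ {t} x → Integral t → P * t + x ≈ x [mod P ]
  P*t+x≈x {t} x it = multiple-of-P it (cancel P t x)
    where
    cancel : ∀ P t x → (P * t + x) - x ≡ P * t
    cancel = solve-∀ ℚ-ring

  p-1≈-1 : ℕ→ℚ (suc n) ≈ - 1ℚ [mod P ]
  p-1≈-1 = multiple-of-P (integral-ℕ 1) (begin
    ℕ→ℚ (suc n) - - 1ℚ    ≡⟨⟩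
    ℕ→ℚ (suc n) + 1ℚ      ≡⟨ ℕ→ℚ-suc (suc n) ⟨
    P                      ≡⟨ ℚₚ.*-identityʳ P ⟨
    P * 1ℚ                 ∎)
    where open ≡-Reasoning

  [p-1]!≈ : ∀ {j} → j ≤ n → ℕ→ℚ (suc n !) ≈ (- 1ℚ) ^ℚ (n ∸ j) * ℕ→ℚ ((n ∸ j) !) * ℕ→ℚ (suc j !) [mod P ]
  [p-1]!≈ {j} j≤n = begin
    ℕ→ℚ (suc n !)                                             ≡⟨ falling-self (suc n) ⟨
    falling (ℕ→ℚ (suc n)) (suc n)                             ≡⟨ cong (falling (ℕ→ℚ (suc n))) m+[1+j]≡1+n ⟨
    falling (ℕ→ℚ (suc n)) (m ℕ.+ suc j)                       ≡⟨ falling-+ (ℕ→ℚ (suc n)) m (suc j) ⟩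
    falling (ℕ→ℚ (suc n)) m * falling (ℕ→ℚ (suc n) - ℕ→ℚ m) (suc j)
      ≡⟨ cong (λ x → falling (ℕ→ℚ (suc n)) m * falling x (suc j)) (ℕ→ℚ-∸ (ℕₚ.≤-trans (ℕₚ.m∸n≤m n j) (ℕₚ.n≤1+n n))) ⟩
    falling (ℕ→ℚ (suc n)) m * falling (ℕ→ℚ (suc n ∸ m)) (suc j)
      ≡⟨ cong (λ k → falling (ℕ→ℚ (suc n)) m * falling (ℕ→ℚ k) (suc j)) [1+n]∸m≡1+j ⟩
    falling (ℕ→ℚ (suc n)) m * falling (ℕ→ℚ (suc j)) (suc j)   ≡⟨ cong (falling (ℕ→ℚ (suc n)) m *_) (falling-self (suc j)) ⟩
    falling (ℕ→ℚ (suc n)) m * ℕ→ℚ (suc j !)                   ≈⟨ *-congʳ (integral-ℕ (suc j !)) p-1↦-1 ⟩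
    falling (- 1ℚ) m * ℕ→ℚ (suc j !)                          ≡⟨ cong (_* ℕ→ℚ (suc j !)) (falling-−1 m) ⟩
    (- 1ℚ) ^ℚ m * ℕ→ℚ (m !) * ℕ→ℚ (suc j !)                   ∎
    where
    open ≈-Reasoning P
    m = n ∸ j
    m+[1+j]≡1+n : m ℕ.+ suc j ≡ suc n
    m+[1+j]≡1+n = trans (ℕₚ.+-suc m j) (cong suc (ℕₚ.m∸n+n≡m j≤n))
    [1+n]∸m≡1+j : suc n ∸ m ≡ suc j
    [1+n]∸m≡1+j = trans (cong (_∸ m) (sym m+[1+j]≡1+n)) (ℕₚ.m+n∸m≡n m (suc j))
    p-1↦-1 : falling (ℕ→ℚ (suc n)) m ≈ falling (- 1ℚ) m [mod P ]
    p-1↦-1 = falling-cong m (integral-ℕ (suc n)) integral-−1 p-1≈-1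

  binomℚ-top-factor : ℚ → ℕ → ℚ
  binomℚ-top-factor t j = falling (P * t + ℕ→ℚ j) j * falling (P * t - 1ℚ) (n ∸ j) * 1/[ suc n !]

  binomℚ-top≡ : ∀ t {j} → j ≤ n → binomℚ (P * t + ℕ→ℚ j) (suc n) ≡ P * (t * binomℚ-top-factor t j)
  binomℚ-top≡ t {j} j≤n = begin
    falling x (suc n) * c                                    ≡⟨ cong (λ k → falling x k * c) j+[1+m]≡1+n ⟨
    falling x (j ℕ.+ suc m) * c                              ≡⟨ cong (_* c) (falling-+ x j (suc m)) ⟩
    falling x j * falling (x - ℕ→ℚ j) (suc m) * c            ≡⟨ cong (λ y → falling x j * falling y (suc m) * c) (cancel (P * t) (ℕ→ℚ j)) ⟩
    falling x j * falling (P * t) (suc m) * c                ≡⟨ cong (λ y → falling x j * y * c) (falling-suc-head (P * t) m) ⟩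
    falling x j * (P * t * falling (P * t - 1ℚ) m) * c       ≡⟨ regroup (falling x j) P t (falling (P * t - 1ℚ) m) c ⟩
    P * (t * binomℚ-top-factor t j)                          ∎
    where
    open ≡-Reasoning
    x = P * t + ℕ→ℚ j
    m = n ∸ j
    c = 1/[ suc n !]
    j+[1+m]≡1+n : j ℕ.+ suc m ≡ suc n
    j+[1+m]≡1+n = trans (ℕₚ.+-suc j m) (cong suc (ℕₚ.m+[n∸m]≡n j≤n))
    cancel : ∀ a b → (a + b) - b ≡ a
    cancel = solve-∀ ℚ-ring
    regroup : ∀ A P t B c → A * (P * t * B) * c ≡ P * (t * (A * B * c))
    regroup = solve-∀ ℚ-ring

  binomℚ-top-factor≈ : ∀ {t j} → j ≤ n → Integral t → binomℚ-top-factor t j ≈ 1/ℕ (suc j) [mod P ]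
  binomℚ-top-factor≈ {t} {j} j≤n it = ≈-1/ℕ (p∤1+ (ℕ.s≤s j≤n)) (begin
    A * B * c * ℕ→ℚ (suc j)                     ≈⟨ *-congʳ (integral-ℕ (suc j)) (*-congʳ ic (*-cong iA is A≈j! B≈s)) ⟩
    ℕ→ℚ (j !) * s * c * ℕ→ℚ (suc j)             ≡⟨ regroup (ℕ→ℚ (j !)) s c (ℕ→ℚ (suc j)) ⟩
    s * (ℕ→ℚ (suc j) * ℕ→ℚ (j !)) * c           ≡⟨ cong (λ f → s * f * c) (ℕ→ℚ-* (suc j) (j !)) ⟨
    s * ℕ→ℚ (suc j !) * c                       ≈⟨ *-congʳ ic (≈-sym ([p-1]!≈ j≤n)) ⟩
    ℕ→ℚ (suc n !) * c                           ≡⟨ !-*-1/[!] (suc n) ⟩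
    1ℚ                                          ∎)
    where
    open ≈-Reasoning P
    m = n ∸ j
    A = falling (P * t + ℕ→ℚ j) j
    B = falling (P * t - 1ℚ) m
    c = 1/[ suc n !]
    s = (- 1ℚ) ^ℚ m * ℕ→ℚ (m !)
    iPt : Integral (P * t)
    iPt = integral-* integral-P it
    ic : Integral c
    ic = integral-1/[!] (ℕₚ.n<1+n (suc n))
    iA : Integral A
    iA = integral-falling j (integral-+ iPt (integral-ℕ j))
    is : Integral s
    is = integral-* (integral-^ m integral-−1) (integral-ℕ (m !))
    A≈j! : A ≈ ℕ→ℚ (j !) [mod P ]
    A≈j! = ≈-trans (falling-cong j (integral-+ iPt (integral-ℕ j)) (integral-ℕ j) (P*t+x≈x (ℕ→ℚ j) it))
                   (≈-reflexive (falling-self j))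
    B≈s : B ≈ s [mod P ]
    B≈s = ≈-trans (falling-cong m (integral-- iPt (integral-ℕ 1)) integral-−1 (P*t-1≈-1 it))
                  (≈-reflexive (falling-−1 m))
    regroup : ∀ f s c k → f * s * c * k ≡ s * (k * f) * c
    regroup = solve-∀ ℚ-ring

  binomℚ-top : ∀ {t j} → j ≤ n → Integral t → binomℚ (P * t + ℕ→ℚ j) (suc n) ≈ P * (t * 1/ℕ (suc j)) [mod P² ]
  binomℚ-top {t} {j} j≤n it = begin
    binomℚ (P * t + ℕ→ℚ j) (suc n)      ≡⟨ binomℚ-top≡ t j≤n ⟩
    P * (t * binomℚ-top-factor t j)     ≈⟨ mod-scale {N = P} (*-congˡ it (binomℚ-top-factor≈ j≤n it)) ⟩
    P * (t * 1/ℕ (suc j))               ∎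
    where open ≈-Reasoning P²

  binomialSum-−2-suc : ∀ x → binomialSum (suc n) (x + 1ℚ) (- ℕ→ℚ 2)
                           ≡ - binomialSum (suc n) x (- ℕ→ℚ 2) + ℕ→ℚ 2 ^ℚ p * binomℚ x (suc n)
  binomialSum-−2-suc x = begin
    binomialSum (suc n) (x + 1ℚ) (- ℕ→ℚ 2)
      ≡⟨ binomialSum-suc (suc n) x (- ℕ→ℚ 2) ⟩
    (1ℚ + - ℕ→ℚ 2) * binomialSum (suc n) x (- ℕ→ℚ 2) - (- ℕ→ℚ 2) ^ℚ p * binomℚ x (suc n)
      ≡⟨ cong (λ w → (1ℚ + - ℕ→ℚ 2) * binomialSum (suc n) x (- ℕ→ℚ 2) - w * binomℚ x (suc n)) (^p-neg (ℕ→ℚ 2)) ⟩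
    (1ℚ + - ℕ→ℚ 2) * binomialSum (suc n) x (- ℕ→ℚ 2) - - (ℕ→ℚ 2 ^ℚ p) * binomℚ x (suc n)
      ≡⟨ simplify (binomialSum (suc n) x (- ℕ→ℚ 2)) (ℕ→ℚ 2 ^ℚ p) (binomℚ x (suc n)) ⟩
    - binomialSum (suc n) x (- ℕ→ℚ 2) + ℕ→ℚ 2 ^ℚ p * binomℚ x (suc n) ∎
    where
    open ≡-Reasoning
    simplify : ∀ F T b → (1ℚ + - (1ℚ + 1ℚ)) * F - - T * b ≡ - F + T * b
    simplify = solve-∀ ℚ-ring

  Y : ℕ → ℚ
  Y zero    = - truncatedLog (- ℕ→ℚ 2)
  Y (suc j) = - Y j - ℕ→ℚ 2 * 1/ℕ (suc j)

  binomialSum-P*+j : ∀ {t} j → j ≤ suc n → Integral t →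
                     binomialSum (suc n) (P * t + ℕ→ℚ j) (- ℕ→ℚ 2) ≈ (- 1ℚ) ^ℚ j - P * (t * Y j) [mod P² ]
  binomialSum-P*+j {t} zero _ it = begin
    binomialSum (suc n) (P * t + 0ℚ) (- ℕ→ℚ 2)      ≡⟨ cong (λ x → binomialSum (suc n) x (- ℕ→ℚ 2)) (ℚₚ.+-identityʳ (P * t)) ⟩
    binomialSum (suc n) (P * t) (- ℕ→ℚ 2)           ≈⟨ binomialSum-P* it (integral-neg (integral-ℕ 2)) ⟩
    1ℚ + P * (t * truncatedLog (- ℕ→ℚ 2))          ≡⟨ rewrite-sign P t (truncatedLog (- ℕ→ℚ 2)) ⟩
    1ℚ - P * (t * - truncatedLog (- ℕ→ℚ 2))        ∎
    where
    open ≈-Reasoning P²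
    rewrite-sign : ∀ P t L → 1ℚ + P * (t * L) ≡ 1ℚ - P * (t * - L)
    rewrite-sign = solve-∀ ℚ-ring
  binomialSum-P*+j {t} (suc j) 1+j≤1+n it = begin
    binomialSum (suc n) (P * t + ℕ→ℚ (suc j)) (- ℕ→ℚ 2)
      ≡⟨ cong (λ x → binomialSum (suc n) x (- ℕ→ℚ 2)) (trans (cong (P * t +_) (ℕ→ℚ-suc j)) (sym (ℚₚ.+-assoc (P * t) (ℕ→ℚ j) 1ℚ))) ⟩
    binomialSum (suc n) (x + 1ℚ) (- ℕ→ℚ 2)
      ≡⟨ binomialSum-−2-suc x ⟩
    - binomialSum (suc n) x (- ℕ→ℚ 2) + ℕ→ℚ 2 ^ℚ p * binomℚ x (suc n)
      ≈⟨ +-cong (neg-cong (binomialSum-P*+j j (ℕₚ.<⇒≤ 1+j≤1+n) it))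
                (*-congˡ (integral-^ p (integral-ℕ 2)) (binomℚ-top (ℕₚ.≤-pred 1+j≤1+n) it)) ⟩
    - ((- 1ℚ) ^ℚ j - P * (t * Y j)) + ℕ→ℚ 2 ^ℚ p * (P * w)
      ≡⟨ cong (- ((- 1ℚ) ^ℚ j - P * (t * Y j)) +_) (swap (ℕ→ℚ 2 ^ℚ p) P w) ⟩
    - ((- 1ℚ) ^ℚ j - P * (t * Y j)) + P * (ℕ→ℚ 2 ^ℚ p * w)
      ≈⟨ +-cong (≈-refl {x = - ((- 1ℚ) ^ℚ j - P * (t * Y j))}) (mod-scale {N = P} (*-congʳ iw (fermat 2))) ⟩
    - ((- 1ℚ) ^ℚ j - P * (t * Y j)) + P * (ℕ→ℚ 2 * w)
      ≡⟨ step ((- 1ℚ) ^ℚ j) P t (Y j) (ℕ→ℚ 2) (1/ℕ (suc j)) ⟩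
    (- 1ℚ) * (- 1ℚ) ^ℚ j - P * (t * (- Y j - ℕ→ℚ 2 * 1/ℕ (suc j))) ∎
    where
    open ≈-Reasoning P²
    x = P * t + ℕ→ℚ j
    w = t * 1/ℕ (suc j)
    iw : Integral w
    iw = integral-* it (integral-1/ℕ (suc j) (p∤1+ 1+j≤1+n))
    swap : ∀ c P w → c * (P * w) ≡ P * (c * w)
    swap = solve-∀ ℚ-ring
    step : ∀ s P t y two i → - (s - P * (t * y)) + P * (two * (t * i)) ≡ (- 1ℚ) * s - P * (t * (- y - two * i))
    step = solve-∀ ℚ-ring

  integral-eulerTable : ∀ m i → Integral (eulerTable m i)
  integral-eulerTable zero    i = integral-ℕ 1
  integral-eulerTable (suc m) i with i ℕ.≤ᵇ m
  ... | true  = integral-eulerTable m i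
  ... | false = integral-neg (integral-sumTo (suc m ℕ./ 2) (λ j _ →
                  integral-* (integral-ℕ (suc m C (2 ℕ.* suc j))) (integral-eulerTable m (suc m ∸ 2 ℕ.* suc j))))

  integral-1/2^ : ∀ m → Integral (1/2^ m)
  integral-1/2^ m = integral-1/ℕ (2 ℕ.^ m) {{ℕₚ.m^n≢0 2 m}} (p∤2^ m)
    where
    p∤2^ : ∀ m → ¬ p ∣ 2 ℕ.^ m
    p∤2^ zero    = p∤1
    p∤2^ (suc m) = p∤* p∤2 (p∤2^ m)

  eulerPoly-cong : ∀ m {x x′} → Integral x → Integral x′ → x ≈ x′ [mod P ] → eulerPoly m x ≈ eulerPoly m x′ [mod P ]
  eulerPoly-cong m {x} {x′} ix ix′ x≈x′ = *-congˡ (integral-1/2^ m) (sumTo-congₘ (suc m) (λ k _ →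
    *-congʳ (integral-eulerTable k k) (*-congˡ (integral-ℕ (m C k)) (^-cong (m ∸ k) (i2x-1 ix) (i2x-1 ix′) 2x-1≈2x′-1))))
    where
    i2x-1 : ∀ {y} → Integral y → Integral (ℕ→ℚ 2 * y - 1ℚ)
    i2x-1 iy = integral-- (integral-* (integral-ℕ 2) iy) (integral-ℕ 1)
    2x-1≈2x′-1 : ℕ→ℚ 2 * x - 1ℚ ≈ ℕ→ℚ 2 * x′ - 1ℚ [mod P ]
    2x-1≈2x′-1 = −-cong (*-congˡ (integral-ℕ 2) x≈x′) (≈-refl {x = 1ℚ})

  X : ℕ → ℚ
  X j = eulerPoly n (- ℕ→ℚ j)

  X-suc : ∀ j → j ≤ n → X (suc j) ≈ - X j - ℕ→ℚ 2 * 1/ℕ (suc j) [mod P ]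
  X-suc j j≤n = begin
    X (suc j)                                       ≡⟨ isolate (X (suc j)) (X j) ⟩
    (X (suc j) + X j) - X j                         ≡⟨ cong (_- X j) (trans (ℚₚ.+-comm (X (suc j)) (X j)) two-terms) ⟩
    ℕ→ℚ 2 * (- ℕ→ℚ (suc j)) ^ℚ n - X j             ≡⟨ cong (λ w → ℕ→ℚ 2 * w - X j) (^n-neg (ℕ→ℚ (suc j))) ⟩
    ℕ→ℚ 2 * - (ℕ→ℚ (suc j) ^ℚ n) - X j             ≈⟨ −-cong (*-congˡ (integral-ℕ 2) (neg-cong (fermat-inverse (suc j) (ℕ.s≤s (ℕ.s≤s j≤n))))) (≈-refl {x = X j}) ⟩
    ℕ→ℚ 2 * - 1/ℕ (suc j) - X j                    ≡⟨ reorder (ℕ→ℚ 2) (1/ℕ (suc j)) (X j) ⟩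
    - X j - ℕ→ℚ 2 * 1/ℕ (suc j)                    ∎
    where
    open ≈-Reasoning P
    isolate : ∀ a b → a ≡ (a + b) - b
    isolate = solve-∀ ℚ-ring
    reorder : ∀ t i x → t * - i - x ≡ - x - t * i
    reorder = solve-∀ ℚ-ring
    -[1+j]+1≡-j : - ℕ→ℚ (suc j) + 1ℚ ≡ - ℕ→ℚ j
    -[1+j]+1≡-j = trans (cong (λ w → - w + 1ℚ) (ℕ→ℚ-suc j)) (cancel (ℕ→ℚ j))
      where
      cancel : ∀ a → - (a + 1ℚ) + 1ℚ ≡ - a
      cancel = solve-∀ ℚ-ring
    two-terms : X j + X (suc j) ≡ ℕ→ℚ 2 * (- ℕ→ℚ (suc j)) ^ℚ n
    two-terms = trans (cong (λ x → eulerPoly n x + X (suc j)) (sym -[1+j]+1≡-j))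
                      (trans (ℚₚ.+-comm _ (X (suc j))) (eulerPoly-+1 n (- ℕ→ℚ (suc j))))

  Y-alternating : ∀ j → (- 1ℚ) ^ℚ j * Y j ≡ Y 0 + ℕ→ℚ 2 * sumTo j logCoeff
  Y-alternating zero    = trans (ℚₚ.*-identityˡ (Y 0)) (sym (trans (cong (Y 0 +_) (ℚₚ.*-zeroʳ (ℕ→ℚ 2))) (ℚₚ.+-identityʳ (Y 0))))
  Y-alternating (suc j) = begin
    (- 1ℚ) * (- 1ℚ) ^ℚ j * (- Y j - ℕ→ℚ 2 * 1/ℕ (suc j))         ≡⟨ expand ((- 1ℚ) ^ℚ j) (Y j) (ℕ→ℚ 2) (1/ℕ (suc j)) ⟩
    (- 1ℚ) ^ℚ j * Y j + ℕ→ℚ 2 * logCoeff j                       ≡⟨ cong (_+ ℕ→ℚ 2 * logCoeff j) (Y-alternating j) ⟩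
    Y 0 + ℕ→ℚ 2 * sumTo j logCoeff + ℕ→ℚ 2 * logCoeff j         ≡⟨ regroup (Y 0) (ℕ→ℚ 2) (sumTo j logCoeff) (logCoeff j) ⟩
    Y 0 + ℕ→ℚ 2 * (sumTo j logCoeff + logCoeff j)               ∎
    where
    open ≡-Reasoning
    expand : ∀ s y t i → (- 1ℚ) * s * (- y - t * i) ≡ s * y + t * (s * i)
    expand = solve-∀ ℚ-ring
    regroup : ∀ a t S l → a + t * S + t * l ≡ a + t * (S + l)
    regroup = solve-∀ ℚ-ring

  Y-top : Y (suc n) ≈ - Y 0 [mod P ]
  Y-top = begin
    Y (suc n)                                    ≡⟨ trans (cong (_* Y (suc n)) -1^p-1) (ℚₚ.*-identityˡ (Y (suc n))) ⟨
    (- 1ℚ) ^ℚ suc n * Y (suc n)                  ≡⟨ Y-alternating (suc n) ⟩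
    Y 0 + ℕ→ℚ 2 * sumTo (suc n) logCoeff         ≡⟨ cong (λ S → Y 0 + ℕ→ℚ 2 * S) (sumTo-cong (suc n) (λ k _ → times-1^ k)) ⟩
    - L₋₂ + ℕ→ℚ 2 * L₁                           ≈⟨ +-cong (neg-cong truncatedLog-−2≈1) (≈-refl {x = ℕ→ℚ 2 * L₁}) ⟩
    - L₁ + ℕ→ℚ 2 * L₁                            ≡⟨ collect L₁ ⟩
    L₁                                           ≈⟨ ≈-sym truncatedLog-−2≈1 ⟩
    L₋₂                                          ≡⟨ ⁻¹-involutive L₋₂ ⟨
    - Y 0                                        ∎
    where
    open ≈-Reasoning P
    L₋₂ = truncatedLog (- ℕ→ℚ 2)
    L₁  = truncatedLog 1ℚ
    times-1^ : ∀ k → logCoeff k ≡ logCoeff k * 1ℚ ^ℚ suc k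
    times-1^ k = sym (trans (cong (logCoeff k *_) (1^ (suc k))) (ℚₚ.*-identityʳ (logCoeff k)))
    collect : ∀ L → - L + ℕ→ℚ 2 * L ≡ L
    collect = solve-∀ ℚ-ring

  X-top : X (suc n) ≈ - X 0 [mod P ]
  X-top = begin
    eulerPoly n (- ℕ→ℚ (suc n))       ≈⟨ eulerPoly-cong n (integral-neg (integral-ℕ (suc n))) (integral-ℕ 1) (neg-cong p-1≈-1) ⟩
    eulerPoly n 1ℚ                    ≡⟨ isolate (eulerPoly n 1ℚ) (X 0) ⟩
    (X 0 + eulerPoly n 1ℚ) - X 0      ≡⟨ cong (_- X 0) (eulerPoly-+1 n 0ℚ) ⟩
    ℕ→ℚ 2 * 0ℚ ^ℚ n - X 0             ≡⟨ cong (λ z → ℕ→ℚ 2 * z - X 0) (trans (cong (0ℚ ^ℚ_) n-odd) (0^-suc (n ℕ./ 2 ℕ.+ n ℕ./ 2))) ⟩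
    ℕ→ℚ 2 * 0ℚ - X 0                  ≡⟨ ℚₚ.+-identityˡ (- X 0) ⟩
    - X 0                             ∎
    where
    open ≈-Reasoning P
    isolate : ∀ a b → a ≡ (b + a) - b
    isolate = solve-∀ ℚ-ring

  X-Y-alternating : ∀ j → j ≤ suc n → X j - Y j ≈ (- 1ℚ) ^ℚ j * (X 0 - Y 0) [mod P ]
  X-Y-alternating zero    _       = ≈-reflexive (sym (ℚₚ.*-identityˡ (X 0 - Y 0)))
  X-Y-alternating (suc j) 1+j≤1+n = begin
    X (suc j) - Y (suc j)                           ≈⟨ −-cong (X-suc j j≤n) (≈-refl {x = Y (suc j)}) ⟩
    (- X j - ℕ→ℚ 2 * 1/ℕ (suc j)) - Y (suc j)        ≡⟨ cancel (X j) (Y j) (ℕ→ℚ 2 * 1/ℕ (suc j)) ⟩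
    - (X j - Y j)                                   ≈⟨ neg-cong (X-Y-alternating j (ℕₚ.<⇒≤ 1+j≤1+n)) ⟩
    - ((- 1ℚ) ^ℚ j * (X 0 - Y 0))                   ≡⟨ sign ((- 1ℚ) ^ℚ j) (X 0 - Y 0) ⟩
    (- 1ℚ) ^ℚ suc j * (X 0 - Y 0)                   ∎
    where
    open ≈-Reasoning P
    j≤n : j ≤ n
    j≤n = ℕₚ.≤-pred 1+j≤1+n
    cancel : ∀ x y d → (- x - d) - (- y - d) ≡ - (x - y)
    cancel = solve-∀ ℚ-ring
    sign : ∀ s d → - (s * d) ≡ (- 1ℚ) * s * d
    sign = solve-∀ ℚ-ring

  ≈-neg⇒≈0 : ∀ {d} → d ≈ - d [mod P ] → d ≈ 0ℚ [mod P ]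
  ≈-neg⇒≈0 {d} d≈-d = begin
    d                        ≡⟨ halve d ⟩
    1/ℕ 2 * (d + d)          ≈⟨ *-congˡ (integral-1/ℕ 2 p∤2) (+-cong d≈-d (≈-refl {x = d})) ⟩
    1/ℕ 2 * (- d + d)        ≡⟨ cong (1/ℕ 2 *_) (ℚₚ.+-inverseˡ d) ⟩
    1/ℕ 2 * 0ℚ               ≡⟨ ℚₚ.*-zeroʳ (1/ℕ 2) ⟩
    0ℚ                       ∎
    where
    open ≈-Reasoning P
    halve : ∀ d → d ≡ 1/ℕ 2 * (d + d)
    halve = solve-∀ ℚ-ring

  X0-Y0≈0 : X 0 - Y 0 ≈ 0ℚ [mod P ]
  X0-Y0≈0 = ≈-neg⇒≈0 (begin
    X 0 - Y 0                            ≡⟨ trans (cong (_* (X 0 - Y 0)) -1^p-1) (ℚₚ.*-identityˡ (X 0 - Y 0)) ⟨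
    (- 1ℚ) ^ℚ suc n * (X 0 - Y 0)        ≈⟨ ≈-sym (X-Y-alternating (suc n) ℕₚ.≤-refl) ⟩
    X (suc n) - Y (suc n)                ≈⟨ −-cong X-top Y-top ⟩
    - X 0 - - Y 0                        ≡⟨ factor (X 0) (Y 0) ⟩
    - (X 0 - Y 0)                        ∎)
    where
    open ≈-Reasoning P
    factor : ∀ x y → - x - - y ≡ - (x - y)
    factor = solve-∀ ℚ-ring

  X≈Y : ∀ j → j ≤ suc n → X j ≈ Y j [mod P ]
  X≈Y j j≤1+n = begin
    X j                                        ≡⟨ isolate (X j) (Y j) ⟩
    (X j - Y j) + Y j                          ≈⟨ +-cong (X-Y-alternating j j≤1+n) (≈-refl {x = Y j}) ⟩
    (- 1ℚ) ^ℚ j * (X 0 - Y 0) + Y j            ≈⟨ +-cong (*-congˡ (integral-^ j integral-−1) X0-Y0≈0) (≈-refl {x = Y j}) ⟩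
    (- 1ℚ) ^ℚ j * 0ℚ + Y j                     ≡⟨ trans (cong (_+ Y j) (ℚₚ.*-zeroʳ ((- 1ℚ) ^ℚ j))) (ℚₚ.+-identityˡ (Y j)) ⟩
    Y j                                        ∎
    where
    open ≈-Reasoning P
    isolate : ∀ x y → x ≡ (x - y) + y
    isolate = solve-∀ ℚ-ring

  binomialSum-−2≈ : ∀ {a} r → r < p → Integral a → a ≈ ℕ→ℚ r [mod P ] →
                    binomialSum (suc n) a (- ℕ→ℚ 2) ≈ (- 1ℚ) ^ℚ r - (a - ℕ→ℚ r) * eulerPoly n (- a) [mod P² ]
  binomialSum-−2≈ {a} r r<p ia (quotient-by t it a-r≡Pt) = begin
    binomialSum (suc n) a (- ℕ→ℚ 2)              ≡⟨ cong (λ x → binomialSum (suc n) x (- ℕ→ℚ 2)) a≡Pt+r ⟩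
    binomialSum (suc n) (P * t + ℕ→ℚ r) (- ℕ→ℚ 2) ≈⟨ binomialSum-P*+j r (ℕₚ.≤-pred r<p) it ⟩
    (- 1ℚ) ^ℚ r - P * (t * Y r)                  ≈⟨ −-cong (≈-refl {x = (- 1ℚ) ^ℚ r}) (mod-scale {N = P} (*-congˡ it Yr≈Eₙ[-a])) ⟩
    (- 1ℚ) ^ℚ r - P * (t * eulerPoly n (- a))    ≡⟨ cong (λ w → (- 1ℚ) ^ℚ r - w) (regroup P t (eulerPoly n (- a))) ⟩
    (- 1ℚ) ^ℚ r - P * t * eulerPoly n (- a)      ≡⟨ cong (λ w → (- 1ℚ) ^ℚ r - w * eulerPoly n (- a)) a-r≡Pt ⟨
    (- 1ℚ) ^ℚ r - (a - ℕ→ℚ r) * eulerPoly n (- a) ∎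
    where
    open ≈-Reasoning P²
    a≡Pt+r : a ≡ P * t + ℕ→ℚ r
    a≡Pt+r = trans (move a (ℕ→ℚ r)) (cong (_+ ℕ→ℚ r) a-r≡Pt)
      where
      move : ∀ a r → a ≡ (a - r) + r
      move = solve-∀ ℚ-ring
    regroup : ∀ P t E → P * (t * E) ≡ P * t * E
    regroup = solve-∀ ℚ-ring
    Yr≈Eₙ[-a] : Y r ≈ eulerPoly n (- a) [mod P ]
    Yr≈Eₙ[-a] = ≈-trans (≈-sym (X≈Y r (ℕₚ.≤-pred r<p)))
                        (eulerPoly-cong n (integral-neg (integral-ℕ r)) (integral-neg ia)
                                        (neg-cong (≈-sym (quotient-by t it a-r≡Pt))))

theorem7p1 : (p : ℕ) → Prime p → 3 < p →
    (a : ℚ) → InZp p a → ¬ CongMod p 1 a 0ℚ →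
    (r : ℕ) → r < p → CongMod p 1 a (ℕ→ℚ r) →
    CongMod p 2
      (sumTo p (λ k → binomℚ a k * ((- ℕ→ℚ 2) ^ℚ k)))
      (((- 1ℚ) ^ℚ r) - ((a - ℕ→ℚ r) * eulerPoly (p ∸ 2) (- a)))
theorem7p1 (suc (suc n)) p-prime 3<p a p∤↧a _ r r<p a≡r =
  ≈⇒CongMod² (binomialSum-−2≈ r r<p (integral p∤↧a) (CongMod¹⇒≈ a≡r))
  where
  open AtPrime n p-prime 3<p
  open Localisation (suc (suc n)) p-prime
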